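{- Fix an integer $d \ge 1$. Define recursively $a(0) := 0$ and, for $i \ge 1$ and $1 \le j \le i$, $b(i,j) := \frac{1}{j!\,d^j}(1 - a(i-j))$ and $a(i) := \sum_{k=1}^i b(i,k)$. For $n,j \in \mathbb{N}$ let $\mathcal{A}_n(d)$ be the set of $g \in S_n$ whose cycle decomposition contains at least one $d$-cycle, and $\mathcal{B}_n(d,j)$ the set of $g \in S_n$ whose cycle decomposition contains precisely $j$ cycles of length $d$. Let $n \ge 2d$ and $i := \lfloor n/d \rfloor$. Then: (a) $n! \cdot a(i) = \#\mathcal{A}_n(d)$; (b) $n! \cdot b(i,j) = \#\mathcal{B}_n(d,j)$ for all $1 \le j \le i$; (c) $n! \cdot \frac{2n-d-1}{n(n-1)}(1 - a(i-1)) = \#\{g \in \mathcal{B}_n(d,1) \mid \text{the unique } d\text{ -cycle of } g \text{ contains } 1 \text{ or } 2\}$; (d) $n! \cdot \frac{1}{n(n-1)}(1 - a(i-2)) = \#\{g \in \mathcal{B}_n(d,2) \mid \text{one } d\text{ -cycle of } g \text{ contains } 1 \text{ and the other contains } 2\}$.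
   Context: $S_n$ is the group of permutations of $\{1,\dots,n\}$; a $d$-cycle of $g$ means a cycle of length exactly $d$ in the cycle decomposition of $g$ (for $d=1$, a fixed point). -}

module Defs where

open import Data.Nat as ℕ using (ℕ; zero; suc; _∸_; _^_; _!; _≤_; _<_; NonZero)
import Data.Nat.Properties as ℕP
open import Data.Integer using (+_)
open import Data.Rational using (ℚ; _/_; 0ℚ; 1ℚ; _+_; _-_; _*_)
open import Data.List using (List; []; _∷_; zipWith; map; upTo; foldr)
open import Data.Fin using (Fin; toℕ)
open import Data.Fin.Permutation using (Permutation′; _⟨$⟩ʳ_)
open import Data.Product using (Σ; ∃; _×_)
open import Relation.Binary.PropositionalEquality using (_≡_; _≢_)

ℕtoℚ : ℕ → ℚ
ℕtoℚ n = + n / 1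

coeff : (d : ℕ) → .{{NonZero d}} → ℕ → ℚ
coeff d j = (+ 1 / (j ! ℕ.* d ^ j)) {{ℕP.m*n≢0 (j !) (d ^ j) {{ℕP._!≢0 j}} {{ℕP.m^n≢0 d j}}}}

ℚsum : List ℚ → ℚ
ℚsum = foldr _+_ 0ℚ

at : List ℚ → ℕ → ℚ
at []       _       = 0ℚ
at (x ∷ xs) zero    = x
at (x ∷ xs) (suc k) = at xs k

-- table d i = [a(i), a(i-1), ..., a(0)]
-- a(0) = 0 and a(i+1) = Σ_{k=1}^{i+1} (1 - a(i+1-k)) / (k! d^k),
-- where a(i+1-k) is entry k-1 of table d i.
table : (d : ℕ) → .{{NonZero d}} → ℕ → List ℚ
table d zero    = 0ℚ ∷ []
table d (suc i) =
  ℚsum (zipWith (λ k x → (1ℚ - x) * coeff d k) (map suc (upTo (suc i))) (table d i))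
  ∷ table d i

aSeq : (d : ℕ) → .{{NonZero d}} → ℕ → ℚ
aSeq d i = at (table d i) 0

bSeq : (d : ℕ) → .{{NonZero d}} → ℕ → ℕ → ℚ
bSeq d i j = (1ℚ - aSeq d (i ∸ j)) * coeff d j

iter : ∀ {A : Set} → (A → A) → ℕ → A → A
iter f zero    x = x
iter f (suc m) x = f (iter f m x)

InDCycle : ∀ {n} → ℕ → Permutation′ n → Fin n → Set
InDCycle d g x =
  iter (g ⟨$⟩ʳ_) d x ≡ x × (∀ m → 0 < m → m < d → iter (g ⟨$⟩ʳ_) m x ≢ x)

HasCardFin : ∀ {n} → (Fin n → Set) → ℕ → Set
HasCardFin {n} P k =
  Σ (Fin k → Fin n) λ f →
    (∀ i → P (f i)) × (∀ i j → f i ≡ f j → i ≡ j) × (∀ x → P x → ∃ λ i → f i ≡ x)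

_≗ₚ_ : ∀ {n} → Permutation′ n → Permutation′ n → Set
g ≗ₚ h = ∀ x → g ⟨$⟩ʳ x ≡ h ⟨$⟩ʳ x

HasCardPerm : ∀ {n} → (Permutation′ n → Set) → ℕ → Set
HasCardPerm {n} P k =
  Σ (Fin k → Permutation′ n) λ f →
    (∀ i → P (f i)) × (∀ i j → f i ≗ₚ f j → i ≡ j) × (∀ g → P g → ∃ λ i → g ≗ₚ f i)

HasDCycle : ∀ {n} → ℕ → Permutation′ n → Set
HasDCycle d g = ∃ λ x → InDCycle d g x

-- g has precisely j cycles of length d  (g ∈ B_n(d,j)):
-- the points lying in d-cycles are exactly j·d in number
ExactlyDCycles : ∀ {n} → ℕ → ℕ → Permutation′ n → Set
ExactlyDCycles d j g = HasCardFin (InDCycle d g) (j ℕ.* d)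

-- g ∈ B_n(d,1) and its d-cycle contains 1 or 2 (i.e. Fin-indices 0 or 1)
SetC : ∀ {n} → ℕ → Permutation′ n → Set
SetC d g = ExactlyDCycles d 1 g × ∃ λ x → (toℕ x ≡ 0 Data.Sum.⊎ toℕ x ≡ 1) × InDCycle d g x
  where import Data.Sum

SetD : ∀ {n} → ℕ → Permutation′ n → Set
SetD d g = ExactlyDCycles d 2 g ×
  ∃ λ x → ∃ λ y → toℕ x ≡ 0 × toℕ y ≡ 1 × InDCycle d g x × InDCycle d g y ×
    (∀ m → iter (g ⟨$⟩ʳ_) m x ≢ y)

nn-1≢0 : ∀ d n → .{{NonZero d}} → 2 ℕ.* d ≤ n → NonZero (n ℕ.* (n ∸ 1))
nn-1≢0 (suc d) (suc (suc n)) _ = _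
nn-1≢0 (suc d) (suc zero) (ℕ.s≤s p) with () ← ℕP.n≤0⇒n≡0 (ℕP.≤-trans (ℕP.m≤n+m 1 d) (ℕP.≤-trans (ℕP.+-monoʳ-≤ d (ℕP.m≤m+n 1 (d ℕ.+ 0))) p))
nn-1≢0 (suc d) zero ()

{-# OPTIONS --safe #-}
-- Let N(S, c) be the number of permutations of a finite set S, |S| = m, with exactly c
-- points on d-cycles. Counting the pairs (g, x) with x on a d-cycle of g in two ways gives
-- c · N(S, c) = m (m-1) ⋯ (m-d+1) · N(S', c - d) with |S'| = m - d: choose the cycle
-- through x, then a permutation of the remaining points. Since coeff d j = (j+1) d ·
-- coeff d (j+1), strong induction on m turns this into N(S, j d) = m! · b(⌊m/d⌋, j) for
-- j ≥ 1; the case j = 0 follows because the N(S, j d) add up to m!, and (a) is its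
-- complement. Parts (c) and (d) count the same decomposition with the cycle rooted at the
-- first point: the rest then has no d-cycle in (c), and in (d) exactly one, through the
-- second point.
module Submission where

open import Level using (0ℓ)
open import Data.Nat as ℕ using (ℕ; zero; suc; _+_; _*_; _∸_; _≤_; _<_; z≤n; s≤s; _!; NonZero)
import Data.Nat.Properties as ℕP
open import Data.Fin as Fin using (Fin; zero; suc; toℕ; fromℕ<; _↑ˡ_; _↑ʳ_; splitAt)
import Data.Fin.Properties as FinP
open import Data.Product using (Σ; ∃; _×_; _,_; proj₁; proj₂)
open import Data.Product.Relation.Binary.Pointwise.NonDependent using (×-setoid)
open import Function using (_∘_; case_of_)
open import Data.Bool as Bool using (Bool; true; _∧_; not)
open import Data.Sum using (_⊎_; inj₁; inj₂)
open import Data.Empty using (⊥-elim)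
open import Data.Unit using (⊤; tt)
open import Data.Nat.Induction using (<-rec)
open import Data.Nat.Divisibility using (_∣_; quotient; _∣0; ∣-refl; ∣m∣n⇒∣m+n)
import Data.Nat.DivMod as ℕ÷
open ℕ÷ using (_/_)
open import Relation.Nullary using (¬_; ¬?; Dec; yes; no; does)
open import Relation.Nullary.Decidable using (_×-dec_; _→-dec_; map′)
open import Relation.Binary using (Setoid; tri<; tri≈; tri>)
open import Algebra.Bundles using (Ring)
open import Relation.Binary.PropositionalEquality
import Algebra.Properties.Semiring.Sum as SemiringSum
open import Data.Integer as ℤ using (+_)
import Data.Integer.Properties as ℤP
open import Data.Rational as ℚ using (ℚ; 1ℚ; _-_; toℚᵘ) renaming (_+_ to _+ℚ_; _*_ to _*ℚ_)
import Data.Rational.Properties as QP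
open import Data.Rational.Unnormalised as ℚᵘ using (mkℚᵘ; *≡*)
import Data.Rational.Unnormalised.Properties as ℚᵘP
open import Data.List using (List; _∷_; zipWith; map; applyUpTo; length)
open import Data.Nat.Solver using () renaming (module +-*-Solver to ℕ-Solver)
open import Data.Rational.Solver using () renaming (module +-*-Solver to ℚ-Solver)
open import Data.Fin.Permutation as Perm using (Permutation′; _⟨$⟩ʳ_; _⟨$⟩ˡ_; inverseˡ; inverseʳ; _∘ₚ_)
import Data.Fin.Permutation.Components as PC
open import Data.Vec using (Vec; []; _∷_; lookup; tabulate)
import Data.Vec.Properties as VecP
open import Defs

-- Counting up to a setoid equivalence

HasCard : ∀ (A : Setoid 0ℓ 0ℓ) → (Setoid.Carrier A → Set) → ℕ → Set
HasCard A P k = Σ (Fin k → Carrier) λ f →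
  (∀ i → P (f i)) × (∀ i j → f i ≈ f j → i ≡ j) × (∀ a → P a → ∃ λ i → a ≈ f i)
  where open Setoid A

module _ (A : Setoid 0ℓ 0ℓ) where
  open Setoid A renaming (refl to ≈-refl; sym to ≈-sym; trans to ≈-trans)

  HasCard-mono-≤ : ∀ {P Q : Carrier → Set} {k k'} → HasCard A P k → HasCard A Q k' →
                   (∀ a → P a → Q a) → k ≤ k'
  HasCard-mono-≤ {k = k} {k'} (e , Pe , e-inj , _) (e' , _ , _ , cover') P⊆Q =
    FinP.injective⇒≤ {f = h} h-injective
    where
    h : Fin k → Fin k'
    h i = proj₁ (cover' (e i) (P⊆Q _ (Pe i)))
    e≈e'∘h : ∀ i → e i ≈ e' (h i)
    e≈e'∘h i = proj₂ (cover' (e i) (P⊆Q _ (Pe i)))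
    h-injective : ∀ {i j} → h i ≡ h j → i ≡ j
    h-injective {i} {j} hi≡hj =
      e-inj i j (≈-trans (e≈e'∘h i) (≈-sym (subst (λ z → e j ≈ e' z) (sym hi≡hj) (e≈e'∘h j))))

  HasCard-≡ : ∀ {P Q : Carrier → Set} {k k'} → HasCard A P k → HasCard A Q k' →
              (∀ a → P a → Q a) → (∀ a → Q a → P a) → k ≡ k'
  HasCard-≡ c c' P⊆Q Q⊆P = ℕP.≤-antisym (HasCard-mono-≤ c c' P⊆Q) (HasCard-mono-≤ c' c Q⊆P)

  HasCard-unique : ∀ {P : Carrier → Set} {k k'} → HasCard A P k → HasCard A P k' → k ≡ k'
  HasCard-unique c c' = HasCard-≡ c c' (λ _ p → p) (λ _ p → p)

  HasCard-resp : ∀ {P Q : Carrier → Set} {k} → HasCard A P k →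
                 (∀ a → P a → Q a) → (∀ a → Q a → P a) → HasCard A Q k
  HasCard-resp (e , Pe , e-inj , cover) P⊆Q Q⊆P =
    e , (λ i → P⊆Q _ (Pe i)) , e-inj , λ a q → cover a (Q⊆P a q)

  HasCard-∅ : ∀ {P : Carrier → Set} → (∀ a → ¬ P a) → HasCard A P 0
  HasCard-∅ empty = (λ ()) , (λ ()) , (λ ()) , λ a p → ⊥-elim (empty a p)

  HasCard-0⇒∅ : ∀ {P : Carrier → Set} → HasCard A P 0 → ∀ a → ¬ P a
  HasCard-0⇒∅ (_ , _ , _ , cover) a p with cover a p
  ... | () , _

  HasCard-suc⇒∃ : ∀ {P : Carrier → Set} {k} → HasCard A P (suc k) → ∃ P
  HasCard-suc⇒∃ (e , Pe , _) = e zero , Pe zero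

  HasCard-singleton : (a₀ : Carrier) → HasCard A (_≈ a₀) 1
  HasCard-singleton a₀ =
    (λ _ → a₀) , (λ _ → ≈-refl) , (λ { zero zero _ → refl }) , λ a p → zero , p

  HasCard-⊎ : ∀ {P Q : Carrier → Set} {k₁ k₂} → HasCard A P k₁ → HasCard A Q k₂ →
              (∀ a b → P a → Q b → ¬ a ≈ b) → HasCard A (λ a → P a ⊎ Q a) (k₁ + k₂)
  HasCard-⊎ {P} {Q} {k₁} {k₂} (e₁ , Pe₁ , e₁-inj , cover₁) (e₂ , Qe₂ , e₂-inj , cover₂) disjoint =
    e ∘ splitAt k₁ , Pe ∘ splitAt k₁ , injective , cover
    where
    e : Fin k₁ ⊎ Fin k₂ → Carrier
    e (inj₁ i) = e₁ i
    e (inj₂ i) = e₂ i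
    Pe : ∀ s → P (e s) ⊎ Q (e s)
    Pe (inj₁ i) = inj₁ (Pe₁ i)
    Pe (inj₂ i) = inj₂ (Qe₂ i)
    e-inj : ∀ s t → e s ≈ e t → s ≡ t
    e-inj (inj₁ i) (inj₁ j) eq = cong inj₁ (e₁-inj i j eq)
    e-inj (inj₁ i) (inj₂ j) eq = ⊥-elim (disjoint _ _ (Pe₁ i) (Qe₂ j) eq)
    e-inj (inj₂ i) (inj₁ j) eq = ⊥-elim (disjoint _ _ (Pe₁ j) (Qe₂ i) (≈-sym eq))
    e-inj (inj₂ i) (inj₂ j) eq = cong inj₂ (e₂-inj i j eq)
    injective : ∀ i j → e (splitAt k₁ i) ≈ e (splitAt k₁ j) → i ≡ j
    injective i j eq = begin
      i                                   ≡⟨ FinP.join-splitAt k₁ k₂ i ⟨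
      Fin.join k₁ k₂ (splitAt k₁ i)       ≡⟨ cong (Fin.join k₁ k₂) (e-inj (splitAt k₁ i) (splitAt k₁ j) eq) ⟩
      Fin.join k₁ k₂ (splitAt k₁ j)       ≡⟨ FinP.join-splitAt k₁ k₂ j ⟩
      j                                   ∎
      where open ≡-Reasoning
    cover : ∀ a → P a ⊎ Q a → ∃ λ i → a ≈ e (splitAt k₁ i)
    cover a (inj₁ p) with cover₁ a p
    ... | i , eq = i ↑ˡ k₂ , subst (λ z → a ≈ e z) (sym (FinP.splitAt-↑ˡ k₁ i k₂)) eq
    cover a (inj₂ q) with cover₂ a q
    ... | i , eq = k₁ ↑ʳ i , subst (λ z → a ≈ e z) (sym (FinP.splitAt-↑ʳ k₁ k₂ i)) eq

module _ (A B : Setoid 0ℓ 0ℓ) where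
  open Setoid A using () renaming (Carrier to A₀; _≈_ to _≈ᴬ_)
  open Setoid B using () renaming (Carrier to B₀; _≈_ to _≈ᴮ_; trans to ≈ᴮ-trans)

  HasCard-bijection : ∀ {P : A₀ → Set} {Q : B₀ → Set} {k} → HasCard A P k → (φ : A₀ → B₀) →
    (∀ a → P a → Q (φ a)) →
    (∀ a a' → P a → P a' → φ a ≈ᴮ φ a' → a ≈ᴬ a') →
    (∀ a a' → P a → a ≈ᴬ a' → φ a ≈ᴮ φ a') →
    (∀ b → Q b → ∃ λ a → P a × b ≈ᴮ φ a) → HasCard B Q k
  HasCard-bijection (e , Pe , e-inj , cover) φ maps-to injective congruent surjective =
    φ ∘ e , (λ i → maps-to _ (Pe i)) ,
    (λ i j eq → e-inj i j (injective _ _ (Pe i) (Pe j) eq)) ,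
    λ b q → let (a , pa , b≈φa) = surjective b q ; (i , a≈ei) = cover a pa in
      i , ≈ᴮ-trans b≈φa (congruent _ _ pa a≈ei)

module ℕ∑ = SemiringSum ℕP.+-*-semiring
open ℕ∑ using (sum)

sum-const : ∀ k m → sum {k} (λ _ → m) ≡ k * m
sum-const zero    m = refl
sum-const (suc k) m = cong (_+_ m) (sum-const k m)

module _ (A : Setoid 0ℓ 0ℓ) where
  open Setoid A renaming (refl to ≈-refl; sym to ≈-sym; trans to ≈-trans)

  HasCard-∑ : ∀ k (F : Fin k → ℕ) (T : Fin k → Carrier → Set) →
    (∀ i → HasCard A (T i) (F i)) →
    (∀ i i' a a' → T i a → T i' a' → a ≈ a' → i ≡ i') →
    HasCard A (λ a → ∃ λ i → T i a) (sum F)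
  HasCard-∑ zero    F T c disjoint = HasCard-∅ A (λ { a (() , _) })
  HasCard-∑ (suc k) F T c disjoint =
    HasCard-resp A (HasCard-⊎ A (c zero) rest
        (λ a b t (i , ti) a≈b → zero≢suc (disjoint zero (suc i) a b t ti a≈b)))
      (λ { a (inj₁ t) → zero , t ; a (inj₂ (i , t)) → suc i , t })
      (λ { a (zero , t) → inj₁ t ; a (suc i , t) → inj₂ (i , t) })
    where
    rest : HasCard A (λ a → ∃ λ i → T (suc i) a) (sum (F ∘ suc))
    rest = HasCard-∑ k (F ∘ suc) (T ∘ suc) (c ∘ suc)
             (λ i i' a a' t t' eq → FinP.suc-injective (disjoint (suc i) (suc i') a a' t t' eq))
    zero≢suc : ∀ {i : Fin k} → zero ≢ suc i
    zero≢suc ()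

module _ {n : ℕ} {Q : Fin (suc n) → Set} {k : ℕ} where

  HasCard-Fin-zero∈ : Q zero → HasCard (setoid (Fin n)) (Q ∘ suc) k →
                      HasCard (setoid (Fin (suc n))) Q (suc k)
  HasCard-Fin-zero∈ q₀ (e , Qe , e-inj , cover) = e' , Qe' , e'-inj , cover'
    where
    e' : Fin (suc k) → Fin (suc n)
    e' zero    = zero
    e' (suc i) = suc (e i)
    Qe' : ∀ i → Q (e' i)
    Qe' zero    = q₀
    Qe' (suc i) = Qe i
    e'-inj : ∀ i j → e' i ≡ e' j → i ≡ j
    e'-inj zero    zero    _  = refl
    e'-inj (suc i) (suc j) eq = cong suc (e-inj i j (FinP.suc-injective eq))
    cover' : ∀ x → Q x → ∃ λ i → x ≡ e' i
    cover' zero    _ = zero , refl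
    cover' (suc x) q = let (i , eq) = cover x q in suc i , cong suc eq

  HasCard-Fin-zero∉ : ¬ Q zero → HasCard (setoid (Fin n)) (Q ∘ suc) k →
                      HasCard (setoid (Fin (suc n))) Q k
  HasCard-Fin-zero∉ ¬q₀ (e , Qe , e-inj , cover) =
    suc ∘ e , Qe , (λ i j eq → e-inj i j (FinP.suc-injective eq)) , cover'
    where
    cover' : ∀ x → Q x → ∃ λ i → x ≡ suc (e i)
    cover' zero    q = ⊥-elim (¬q₀ q)
    cover' (suc x) q = let (i , eq) = cover x q in i , cong suc eq

HasCard-Fin-split : ∀ n (Q : Fin n → Set) → (∀ x → Dec (Q x)) →
  Σ ℕ λ k₁ → Σ ℕ λ k₂ →
    HasCard (setoid (Fin n)) Q k₁ × HasCard (setoid (Fin n)) (¬_ ∘ Q) k₂ × k₁ + k₂ ≡ n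
HasCard-Fin-split zero    Q Q? =
  0 , 0 , HasCard-∅ (setoid _) (λ ()) , HasCard-∅ (setoid _) (λ ()) , refl
HasCard-Fin-split (suc n) Q Q? with HasCard-Fin-split n (Q ∘ suc) (Q? ∘ suc) | Q? zero
... | k₁ , k₂ , c₁ , c₂ , k₁+k₂≡n | yes q₀ =
  suc k₁ , k₂ , HasCard-Fin-zero∈ q₀ c₁ , HasCard-Fin-zero∉ (λ ¬q₀ → ¬q₀ q₀) c₂ , cong suc k₁+k₂≡n
... | k₁ , k₂ , c₁ , c₂ , k₁+k₂≡n | no ¬q₀ =
  k₁ , suc k₂ , HasCard-Fin-zero∉ ¬q₀ c₁ , HasCard-Fin-zero∈ ¬q₀ c₂ ,
  trans (ℕP.+-suc k₁ k₂) (cong suc k₁+k₂≡n)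

module _ (A : Setoid 0ℓ 0ℓ) where
  open Setoid A renaming (refl to ≈-refl; sym to ≈-sym; trans to ≈-trans)

  HasCard-split : ∀ {P : Carrier → Set} {k} → HasCard A P k →
    (Q : Carrier → Set) → (∀ a → Dec (Q a)) → (∀ a b → a ≈ b → Q a → Q b) →
    Σ ℕ λ k₁ → Σ ℕ λ k₂ →
      HasCard A (λ a → P a × Q a) k₁ × HasCard A (λ a → P a × ¬ Q a) k₂ × k₁ + k₂ ≡ k
  HasCard-split {P} {k} (e , Pe , e-inj , cover) Q Q? Q-resp
    with HasCard-Fin-split k (Q ∘ e) (Q? ∘ e)
  ... | k₁ , k₂ , c₁ , c₂ , k₁+k₂≡k =
    k₁ , k₂ ,
    HasCard-bijection (setoid _) A c₁ e (λ i q → Pe i , q) e-inj'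
      (λ { i .i _ refl → ≈-refl })
      (λ a (pa , qa) → let (i , a≈ei) = cover a pa in i , Q-resp _ _ a≈ei qa , a≈ei) ,
    HasCard-bijection (setoid _) A c₂ e (λ i q → Pe i , q) e-inj'
      (λ { i .i _ refl → ≈-refl })
      (λ a (pa , ¬qa) → let (i , a≈ei) = cover a pa in
         i , (λ q → ¬qa (Q-resp _ _ (≈-sym a≈ei) q)) , a≈ei) ,
    k₁+k₂≡k
    where
    e-inj' : ∀ {R : Fin k → Set} i j → R i → R j → e i ≈ e j → i ≡ j
    e-inj' i j _ _ = e-inj i j

module _ (A B : Setoid 0ℓ 0ℓ) where
  open Setoid A using () renaming (Carrier to A₀; _≈_ to _≈ᴬ_; sym to ≈ᴬ-sym; trans to ≈ᴬ-trans; refl to ≈ᴬ-refl)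
  open Setoid B using () renaming (Carrier to B₀; refl to ≈ᴮ-refl)

  HasCard-Σ : ∀ {P : A₀ → Set} {R : A₀ → B₀ → Set} {k} (C : HasCard A P k) (F : Fin k → ℕ) →
    (∀ i → HasCard B (R (proj₁ C i)) (F i)) →
    (∀ a a' → a ≈ᴬ a' → P a → P a') →
    (∀ a a' b → a ≈ᴬ a' → R a b → R a' b) →
    HasCard (×-setoid A B) (λ (a , b) → P a × R a b) (sum F)
  HasCard-Σ {P} {R} {k} (e , Pe , e-inj , cover) F fibre P-resp R-resp =
    HasCard-resp (×-setoid A B) union
      (λ { (a , b) (i , a≈ei , r) → P-resp _ _ (≈ᴬ-sym a≈ei) (Pe i) , R-resp _ _ b (≈ᴬ-sym a≈ei) r })
      (λ { (a , b) (pa , r) → let (i , a≈ei) = cover a pa in i , a≈ei , R-resp _ _ b a≈ei r })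
    where
    T : Fin k → A₀ × B₀ → Set
    T i (a , b) = a ≈ᴬ e i × R (e i) b
    union : HasCard (×-setoid A B) (λ ab → ∃ λ i → T i ab) (sum F)
    union = HasCard-∑ (×-setoid A B) k F T
      (λ i → HasCard-bijection B (×-setoid A B) (fibre i) (e i ,_) (λ b r → ≈ᴬ-refl , r)
         (λ b b' _ _ → proj₂) (λ b b' _ b≈b' → ≈ᴬ-refl , b≈b')
         (λ { (a , b) (a≈ei , r) → b , r , a≈ei , ≈ᴮ-refl }))
      (λ { i i' (a , b) (a' , b') (a≈ei , _) (a'≈ei' , _) (a≈a' , _) →
           e-inj i i' (≈ᴬ-trans (≈ᴬ-sym a≈ei) (≈ᴬ-trans a≈a' a'≈ei')) })

-- Iteration and permutations

module _ {A : Set} (f : A → A) where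

  iter-+ : ∀ m k x → iter f (m + k) x ≡ iter f m (iter f k x)
  iter-+ zero    k x = refl
  iter-+ (suc m) k x = cong f (iter-+ m k x)

  iter-comm : ∀ m k x → iter f m (iter f k x) ≡ iter f k (iter f m x)
  iter-comm m k x = begin
    iter f m (iter f k x) ≡⟨ iter-+ m k x ⟨
    iter f (m + k) x      ≡⟨ cong (λ l → iter f l x) (ℕP.+-comm m k) ⟩
    iter f (k + m) x      ≡⟨ iter-+ k m x ⟩
    iter f k (iter f m x) ∎
    where open ≡-Reasoning

  iter-injective : (∀ x y → f x ≡ f y → x ≡ y) → ∀ m x y → iter f m x ≡ iter f m y → x ≡ y
  iter-injective f-inj zero    x y eq = eq
  iter-injective f-inj (suc m) x y eq = iter-injective f-inj m x y (f-inj _ _ eq)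

iter-cong : ∀ {A : Set} {f g : A → A} → (∀ y → f y ≡ g y) → ∀ m x → iter f m x ≡ iter g m x
iter-cong f≗g zero    x = refl
iter-cong {g = g} f≗g (suc m) x = trans (f≗g _) (cong g (iter-cong f≗g m x))

injective⇒surjective : ∀ {n} (f : Fin n → Fin n) → (∀ x y → f x ≡ f y → x ≡ y) →
                       ∀ y → ∃ λ x → f x ≡ y
injective⇒surjective {suc n} f f-inj y with FinP.any? (λ x → f x FinP.≟ y)
... | yes p  = p
... | no ¬p = ⊥-elim (ℕP.<-irrefl refl (FinP.injective⇒≤ {f = h} h-injective))
  where
  -- punching the missed value y out of the codomain gives an injection Fin (suc n) → Fin n
  h : Fin (suc n) → Fin n
  h x = Fin.punchOut {i = y} {j = f x} (λ eq → ¬p (x , sym eq))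
  h-injective : ∀ {a b} → h a ≡ h b → a ≡ b
  h-injective {a} {b} eq =
    f-inj a b (FinP.punchOut-injective (λ e → ¬p (a , sym e)) (λ e → ¬p (b , sym e)) eq)

injection⇒permutation : ∀ {n} (f : Fin n → Fin n) → (∀ x y → f x ≡ f y → x ≡ y) → Permutation′ n
injection⇒permutation f f-inj =
  Perm.permutation f (proj₁ ∘ surjective) (proj₂ ∘ surjective) (λ x → f-inj _ _ (proj₂ (surjective (f x))))
  where
  surjective : ∀ y → ∃ λ x → f x ≡ y
  surjective = injective⇒surjective f f-inj

module _ {n : ℕ} (i j : Fin n) where

  transpose-matchˡ : PC.transpose i j i ≡ j
  transpose-matchˡ with i FinP.≟ i
  ... | yes _   = refl
  ... | no i≢i = ⊥-elim (i≢i refl)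

  transpose-matchʳ : PC.transpose i j j ≡ i
  transpose-matchʳ with j FinP.≟ i
  ... | yes j≡i = j≡i
  ... | no _ with j FinP.≟ j
  ...   | yes _   = refl
  ...   | no j≢j = ⊥-elim (j≢j refl)

  transpose-other : ∀ {k} → k ≢ i → k ≢ j → PC.transpose i j k ≡ k
  transpose-other {k} k≢i k≢j with k FinP.≟ i
  ... | yes k≡i = ⊥-elim (k≢i k≡i)
  ... | no _ with k FinP.≟ j
  ...   | yes k≡j = ⊥-elim (k≢j k≡j)
  ...   | no _    = refl

module Permutations (N : ℕ) where

  Perm : Set
  Perm = Permutation′ N

  infixl 20 _·_
  _·_ : Perm → Fin N → Fin N
  g · x = g ⟨$⟩ʳ x

  ·-injective : ∀ (g : Perm) x y → g · x ≡ g · y → x ≡ y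
  ·-injective g x y eq = trans (sym (inverseˡ g)) (trans (cong (g ⟨$⟩ˡ_) eq) (inverseˡ g))

  ·⇒⟨$⟩ˡ : ∀ (g : Perm) {a b} → g · a ≡ b → g ⟨$⟩ˡ b ≡ a
  ·⇒⟨$⟩ˡ g refl = inverseˡ g

  -- HasCardPerm of Defs is HasCard permSetoid.
  permSetoid : Setoid 0ℓ 0ℓ
  permSetoid = record
    { Carrier       = Perm
    ; _≈_           = _≗ₚ_
    ; isEquivalence = record
      { refl  = λ _ → refl
      ; sym   = λ g≗h x → sym (g≗h x)
      ; trans = λ g≗h h≗k x → trans (g≗h x) (h≗k x) } }

  Finₛ : Setoid 0ℓ 0ℓ
  Finₛ = setoid (Fin N)

  infixl 20 _^_·_
  _^_·_ : Perm → ℕ → Fin N → Fin N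
  g ^ m · x = iter (g ⟨$⟩ʳ_) m x

  ^-cong : ∀ {g h : Perm} → g ≗ₚ h → ∀ m x → g ^ m · x ≡ h ^ m · x
  ^-cong g≗h = iter-cong g≗h

  ^-injective : ∀ (g : Perm) m x y → g ^ m · x ≡ g ^ m · y → x ≡ y
  ^-injective g = iter-injective (g ⟨$⟩ʳ_) (·-injective g)

  InDCycle? : ∀ d g x → Dec (InDCycle d g x)
  InDCycle? d g x =
    (g ^ d · x FinP.≟ x) ×-dec
    map′ (λ f m 0<m m<d → f m<d 0<m) (λ f {m} m<d 0<m → f m 0<m m<d)
      (ℕP.allUpTo? (λ m → (0 ℕP.<? m) →-dec ¬? (g ^ m · x FinP.≟ x)) d)

  InDCycle-resp : ∀ d {g h : Perm} → g ≗ₚ h → ∀ x → InDCycle d g x → InDCycle d h x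
  InDCycle-resp d {g} {h} g≗h x (closes , minimal) =
    trans (sym (^-cong {g} {h} g≗h d x)) closes ,
    λ m 0<m m<d returns → minimal m 0<m m<d (trans (^-cong {g} {h} g≗h m x) returns)

  Subset : Set
  Subset = Fin N → Bool

  infix 4 _∈_
  _∈_ : Fin N → Subset → Set
  y ∈ S = S y ≡ true

  infix 4 _∈?_
  _∈?_ : ∀ y S → Dec (y ∈ S)
  y ∈? S = S y Bool.≟ true

  abstract
    ∣_∣ : Subset → ℕ
    ∣ S ∣ = proj₁ (HasCard-Fin-split N (_∈ S) (_∈? S))

    ∣∣-HasCard : ∀ S → HasCard Finₛ (_∈ S) ∣ S ∣
    ∣∣-HasCard S = proj₁ (proj₂ (proj₂ (HasCard-Fin-split N (_∈ S) (_∈? S))))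

  module _ (S : Subset) {Q : Fin N → Set} (Q? : ∀ y → Dec (Q y)) where

    minus : Subset
    minus y = S y ∧ not (does (Q? y))

    ∈-minus⁻ : ∀ {y} → y ∈ minus → y ∈ S × ¬ Q y
    ∈-minus⁻ {y} y∈ with S y | Q? y
    ... | true | no ¬q = refl , ¬q

    ∈-minus⁺ : ∀ {y} → y ∈ S → ¬ Q y → y ∈ minus
    ∈-minus⁺ {y} y∈S ¬q with S y | Q? y
    ... | true | no _ = refl
    ... | true | yes q = ⊥-elim (¬q q)

    ∣minus∣ : ∀ {k} → HasCard Finₛ Q k → (∀ y → Q y → y ∈ S) → ∣ S ∣ ≡ ∣ minus ∣ + k
    ∣minus∣ Q-card Q⊆S = HasCard-≡ Finₛ (∣∣-HasCard S)
      (HasCard-⊎ Finₛ (∣∣-HasCard minus) Q-card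
        (λ y y' y∈ q y≡y' → proj₂ (∈-minus⁻ y∈) (subst Q (sym y≡y') q)))
      (λ y y∈S → case Q? y of λ where
         (yes q) → inj₂ q
         (no ¬q) → inj₁ (∈-minus⁺ y∈S ¬q))
      (λ where y (inj₁ y∈) → proj₁ (∈-minus⁻ y∈)
               y (inj₂ q)  → Q⊆S y q)

  _─_ : Subset → Fin N → Subset
  S ─ x = minus S (FinP._≟ x)

  ∣─∣ : ∀ {S x} → x ∈ S → ∣ S ∣ ≡ suc ∣ S ─ x ∣
  ∣─∣ {S} {x} x∈S = trans (∣minus∣ S (FinP._≟ x) (HasCard-singleton Finₛ x) λ { _ refl → x∈S })
                          (ℕP.+-comm _ 1)

  Sym : Subset → Perm → Set
  Sym S g = ∀ y → ¬ y ∈ S → g · y ≡ y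

  Sym-resp : ∀ S {g h} → g ≗ₚ h → Sym S g → Sym S h
  Sym-resp S g≗h g∈Sym y y∉S = trans (sym (g≗h y)) (g∈Sym y y∉S)

  Sym-fixes : ∀ {S x h} → Sym (S ─ x) h → h · x ≡ x
  Sym-fixes {S} {x} h∈Sym = h∈Sym x (λ x∈ → proj₂ (∈-minus⁻ S (FinP._≟ x) x∈) refl)

  Sym-closed : ∀ {S g y} → Sym S g → y ∈ S → g · y ∈ S
  Sym-closed {S} {g} {y} g∈Sym y∈S with g · y ∈? S
  ... | yes gy∈S = gy∈S
  ... | no gy∉S = ⊥-elim (gy∉S (subst (_∈ S) (sym (·-injective g _ _ (g∈Sym _ gy∉S))) y∈S))

  -- detach x g fixes x and otherwise agrees with g, except that g⁻¹ x is sent to g x;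
  -- attach x z h undoes this, sending x to z.
  detach : Fin N → Perm → Perm
  detach x g = Perm.transpose x (g ⟨$⟩ˡ x) ∘ₚ g

  attach : Fin N → Fin N → Perm → Perm
  attach x z h = Perm.transpose (h ⟨$⟩ˡ z) x ∘ₚ h

  attach-· : ∀ x z h → attach x z h · x ≡ z
  attach-· x z h = trans (cong (h ·_) (transpose-matchʳ (h ⟨$⟩ˡ z) x)) (inverseʳ h)

  attach-detach : ∀ x g → attach x (g · x) (detach x g) ≗ₚ g
  attach-detach x g y = begin
    h · PC.transpose (h ⟨$⟩ˡ (g · x)) x y ≡⟨ cong (λ b → h · PC.transpose b x y) h⁻¹gx≡b ⟩
    g · PC.transpose x b (PC.transpose b x y) ≡⟨ cong (g ·_) (PC.transpose-inverse x b) ⟩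
    g · y ∎
    where
    open ≡-Reasoning
    h : Perm
    h = detach x g
    b : Fin N
    b = g ⟨$⟩ˡ x
    h⁻¹gx≡b : h ⟨$⟩ˡ (g · x) ≡ b
    h⁻¹gx≡b = ·⇒⟨$⟩ˡ h (cong (g ·_) (transpose-matchʳ x b))

  detach-attach : ∀ {S} x z h → Sym (S ─ x) h → detach x (attach x z h) ≗ₚ h
  detach-attach {S} x z h h∈Sym y = begin
    g · PC.transpose x (g ⟨$⟩ˡ x) y          ≡⟨ cong (λ b → g · PC.transpose x b y) g⁻¹x≡b ⟩
    h · PC.transpose b x (PC.transpose x b y) ≡⟨ cong (h ·_) (PC.transpose-inverse b x) ⟩
    h · y ∎
    where
    open ≡-Reasoning
    g : Perm
    g = attach x z h
    b : Fin N
    b = h ⟨$⟩ˡ z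
    g⁻¹x≡b : g ⟨$⟩ˡ x ≡ b
    g⁻¹x≡b = ·⇒⟨$⟩ˡ g (trans (cong (h ·_) (transpose-matchˡ b x)) (Sym-fixes {S} {x} {h} h∈Sym))

  detach-Sym : ∀ {S x g} → x ∈ S → Sym S g → Sym (S ─ x) (detach x g)
  detach-Sym {S} {x} {g} x∈S g∈Sym y y∉ = fixed (y FinP.≟ x)
    where
    gy≡y : y ≢ x → g · y ≡ y
    gy≡y y≢x = g∈Sym y (λ y∈S → y∉ (∈-minus⁺ S (FinP._≟ x) y∈S y≢x))
    y≢g⁻¹x : y ≢ x → y ≢ g ⟨$⟩ˡ x
    y≢g⁻¹x y≢x y≡ = y≢x (trans (sym (gy≡y y≢x)) (trans (cong (g ·_) y≡) (inverseʳ g)))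
    fixed : Dec (y ≡ x) → detach x g · y ≡ y
    fixed (yes refl) = trans (cong (g ·_) (transpose-matchˡ x (g ⟨$⟩ˡ x))) (inverseʳ g)
    fixed (no y≢x)   = trans (cong (g ·_) (transpose-other x (g ⟨$⟩ˡ x) y≢x (y≢g⁻¹x y≢x))) (gy≡y y≢x)

  attach-Sym : ∀ {S x z h} → x ∈ S → z ∈ S → Sym (S ─ x) h → Sym S (attach x z h)
  attach-Sym {S} {x} {z} {h} x∈S z∈S h∈Sym y y∉S =
    trans (cong (h ·_) (transpose-other (h ⟨$⟩ˡ z) x y≢h⁻¹z y≢x)) hy≡y
    where
    y≢x : y ≢ x
    y≢x refl = y∉S x∈S
    hy≡y : h · y ≡ y
    hy≡y = h∈Sym y (λ y∈ → y∉S (proj₁ (∈-minus⁻ S (FinP._≟ x) y∈)))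
    y≢h⁻¹z : y ≢ h ⟨$⟩ˡ z
    y≢h⁻¹z y≡ = y∉S (subst (_∈ S) (trans (sym (trans (cong (h ·_) y≡) (inverseʳ h))) hy≡y) z∈S)

  attach-cong : ∀ x z {h h'} → h ≗ₚ h' → attach x z h ≗ₚ attach x z h'
  attach-cong x z {h} {h'} h≗h' y =
    trans (cong (λ b → h · PC.transpose b x y) (·⇒⟨$⟩ˡ h (trans (h≗h' _) (inverseʳ h'))))
          (h≗h' _)

  detach-cong : ∀ x {g g'} → g ≗ₚ g' → detach x g ≗ₚ detach x g'
  detach-cong x {g} {g'} g≗g' y =
    trans (cong (λ b → g · PC.transpose x b y) (·⇒⟨$⟩ˡ g (trans (g≗g' _) (inverseʳ g'))))
          (g≗g' _)

  -- For a fixed x ∈ S, g ↦ (g x , detach x g) is a bijection Sym S ≅ S × Sym (S ─ x).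
  Sym-HasCard : ∀ m S → ∣ S ∣ ≡ m → HasCard permSetoid (Sym S) (m !)
  Sym-HasCard zero S ∣S∣≡0 = HasCard-resp permSetoid (HasCard-singleton permSetoid Perm.id)
    (λ g g≗id y _ → g≗id y)
    (λ g g∈Sym y → g∈Sym y (HasCard-0⇒∅ Finₛ (subst (HasCard Finₛ (_∈ S)) ∣S∣≡0 (∣∣-HasCard S)) y))
  Sym-HasCard (suc m) S ∣S∣≡1+m =
    HasCard-bijection pairₛ permSetoid pairs (λ (z , h) → attach x z h)
      (λ (z , h) (z∈S , h∈Sym) → attach-Sym {S} {x} {z} {h} x∈S z∈S h∈Sym)
      (λ (z , h) (z' , h') (_ , h∈Sym) (_ , h'∈Sym) g≗g' →
         trans (sym (attach-· x z h)) (trans (g≗g' x) (attach-· x z' h')) ,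
         λ y → trans (sym (detach-attach x z h h∈Sym y))
                 (trans (detach-cong x {attach x z h} {attach x z' h'} g≗g' y) (detach-attach x z' h' h'∈Sym y)))
      (λ { (z , h) (z' , h') _ (refl , h≗h') → attach-cong x z {h} {h'} h≗h' })
      (λ g g∈Sym → (g · x , detach x g) , (Sym-closed {S} {g} g∈Sym x∈S , detach-Sym {S} {x} {g} x∈S g∈Sym) ,
                   λ y → sym (attach-detach x g y))
    where
    pairₛ : Setoid 0ℓ 0ℓ
    pairₛ = ×-setoid Finₛ permSetoid
    S-card : HasCard Finₛ (_∈ S) (suc m)
    S-card = subst (HasCard Finₛ (_∈ S)) ∣S∣≡1+m (∣∣-HasCard S)
    x : Fin N
    x = proj₁ (HasCard-suc⇒∃ Finₛ S-card)
    x∈S : x ∈ S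
    x∈S = proj₂ (HasCard-suc⇒∃ Finₛ S-card)
    ∣S─x∣≡m : ∣ S ─ x ∣ ≡ m
    ∣S─x∣≡m = ℕP.suc-injective (trans (sym (∣─∣ x∈S)) ∣S∣≡1+m)
    pairs : HasCard pairₛ (λ (z , h) → z ∈ S × Sym (S ─ x) h) (suc m !)
    pairs = subst (HasCard pairₛ _) (sum-const (suc m) (m !))
      (HasCard-Σ Finₛ permSetoid S-card (λ _ → m !) (λ _ → Sym-HasCard m (S ─ x) ∣S─x∣≡m)
         (λ { _ _ refl z∈S → z∈S }) (λ _ _ _ _ h∈Sym → h∈Sym))

  injective? : (f : Fin N → Fin N) → Dec (∀ x y → f x ≡ f y → x ≡ y)
  injective? f = FinP.all? λ x → FinP.all? λ y → (f x FinP.≟ f y) →-dec (x FinP.≟ y)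

  -- A total version of injection⇒permutation (junk value: the identity), so that
  -- permutations can be built from functions whose injectivity needs hypotheses.
  permutationOf : (Fin N → Fin N) → Perm
  permutationOf f with injective? f
  ... | yes f-inj = injection⇒permutation f f-inj
  ... | no _      = Perm.id

  permutationOf-· : ∀ f → (∀ x y → f x ≡ f y → x ≡ y) → ∀ y → permutationOf f · y ≡ f y
  permutationOf-· f f-inj y with injective? f
  ... | yes _     = refl
  ... | no ¬f-inj = ⊥-elim (¬f-inj f-inj)

  permutationOf-cong : ∀ f f' → (∀ y → f y ≡ f' y) → permutationOf f ≗ₚ permutationOf f'
  permutationOf-cong f f' f≗f' y with injective? f | injective? f'
  ... | yes _     | yes _      = f≗f' y
  ... | no _      | no _       = refl
  ... | yes f-inj | no ¬f'-inj =
    ⊥-elim (¬f'-inj λ a b eq → f-inj a b (trans (f≗f' a) (trans eq (sym (f≗f' b)))))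
  ... | no ¬f-inj | yes f'-inj =
    ⊥-elim (¬f-inj λ a b eq → f'-inj a b (trans (sym (f≗f' a)) (trans eq (f≗f' b))))

-- Rational arithmetic

module ℚ∑ = SemiringSum (Ring.semiring QP.+-*-ring)

-- Identities in ℚ are transported along the injective ring homomorphism toℚᵘ.

toℚᵘ-ℕtoℚ : ∀ n → toℚᵘ (ℕtoℚ n) ℚᵘ.≃ mkℚᵘ (+ n) 0
toℚᵘ-ℕtoℚ n = QP.toℚᵘ-fromℚᵘ (mkℚᵘ (+ n) 0)

ℕtoℚ-+ : ∀ a b → ℕtoℚ (a + b) ≡ ℕtoℚ a +ℚ ℕtoℚ b
ℕtoℚ-+ a b = QP.toℚᵘ-injective (ℚᵘP.≃-trans (toℚᵘ-ℕtoℚ (a + b))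
  (ℚᵘP.≃-trans homo (ℚᵘP.≃-sym (ℚᵘP.≃-trans (QP.toℚᵘ-homo-+ (ℕtoℚ a) (ℕtoℚ b))
                                               (ℚᵘP.+-cong (toℚᵘ-ℕtoℚ a) (toℚᵘ-ℕtoℚ b))))))
  where
  homo : mkℚᵘ (+ (a + b)) 0 ℚᵘ.≃ (mkℚᵘ (+ a) 0 ℚᵘ.+ mkℚᵘ (+ b) 0)
  homo = *≡* (cong (ℤ._* + 1) (trans (ℤP.pos-+ a b)
           (sym (cong₂ ℤ._+_ (ℤP.*-identityʳ (+ a)) (ℤP.*-identityʳ (+ b))))))

ℕtoℚ-* : ∀ a b → ℕtoℚ (a * b) ≡ ℕtoℚ a *ℚ ℕtoℚ b
ℕtoℚ-* a b = QP.toℚᵘ-injective (ℚᵘP.≃-trans (toℚᵘ-ℕtoℚ (a * b))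
  (ℚᵘP.≃-trans homo (ℚᵘP.≃-sym (ℚᵘP.≃-trans (QP.toℚᵘ-homo-* (ℕtoℚ a) (ℕtoℚ b))
                                               (ℚᵘP.*-cong (toℚᵘ-ℕtoℚ a) (toℚᵘ-ℕtoℚ b))))))
  where
  homo : mkℚᵘ (+ (a * b)) 0 ℚᵘ.≃ (mkℚᵘ (+ a) 0 ℚᵘ.* mkℚᵘ (+ b) 0)
  homo = *≡* (cong (ℤ._* + 1) (ℤP.pos-* a b))

toℚᵘ-/ : ∀ a b → toℚᵘ (+ a ℚ./ suc b) ℚᵘ.≃ mkℚᵘ (+ a) b
toℚᵘ-/ a b = QP.toℚᵘ-fromℚᵘ (mkℚᵘ (+ a) b)

1/n*n≡1 : ∀ n .{{_ : NonZero n}} → (+ 1 ℚ./ n) *ℚ ℕtoℚ n ≡ 1ℚ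
1/n*n≡1 (suc n) = QP.toℚᵘ-injective (ℚᵘP.≃-trans (QP.toℚᵘ-homo-* (+ 1 ℚ./ suc n) (ℕtoℚ (suc n)))
  (ℚᵘP.≃-trans (ℚᵘP.*-cong (toℚᵘ-/ 1 n) (toℚᵘ-ℕtoℚ (suc n))) (ℚᵘP.*-inverseˡ (mkℚᵘ (+ suc n) 0))))

a/n≡a*1/n : ∀ a n .{{_ : NonZero n}} → + a ℚ./ n ≡ ℕtoℚ a *ℚ (+ 1 ℚ./ n)
a/n≡a*1/n a (suc n) = QP.toℚᵘ-injective (ℚᵘP.≃-trans (toℚᵘ-/ a n)
  (ℚᵘP.≃-trans split (ℚᵘP.≃-sym (ℚᵘP.≃-trans (QP.toℚᵘ-homo-* (ℕtoℚ a) (+ 1 ℚ./ suc n))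
                                                (ℚᵘP.*-cong (toℚᵘ-ℕtoℚ a) (toℚᵘ-/ 1 n))))))
  where
  split : mkℚᵘ (+ a) n ℚᵘ.≃ (mkℚᵘ (+ a) 0 ℚᵘ.* mkℚᵘ (+ 1) n)
  split = *≡* (cong₂ ℤ._*_ (sym (ℤP.*-identityʳ (+ a))) (cong (λ z → + suc z) (ℕP.+-identityʳ n)))

*-cancelʳ-ℕtoℚ : ∀ n .{{_ : NonZero n}} p q → p *ℚ ℕtoℚ n ≡ q *ℚ ℕtoℚ n → p ≡ q
*-cancelʳ-ℕtoℚ n p q eq = begin
  p                          ≡⟨ QP.*-identityʳ p ⟨
  p *ℚ 1ℚ                    ≡⟨ cong (p *ℚ_) n*1/n≡1 ⟨
  p *ℚ (ℕtoℚ n *ℚ (+ 1 ℚ./ n)) ≡⟨ QP.*-assoc p (ℕtoℚ n) (+ 1 ℚ./ n) ⟨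
  (p *ℚ ℕtoℚ n) *ℚ (+ 1 ℚ./ n) ≡⟨ cong (_*ℚ (+ 1 ℚ./ n)) eq ⟩
  (q *ℚ ℕtoℚ n) *ℚ (+ 1 ℚ./ n) ≡⟨ QP.*-assoc q (ℕtoℚ n) (+ 1 ℚ./ n) ⟩
  q *ℚ (ℕtoℚ n *ℚ (+ 1 ℚ./ n)) ≡⟨ cong (q *ℚ_) n*1/n≡1 ⟩
  q *ℚ 1ℚ                    ≡⟨ QP.*-identityʳ q ⟩
  q                          ∎
  where
  open ≡-Reasoning
  n*1/n≡1 : ℕtoℚ n *ℚ (+ 1 ℚ./ n) ≡ 1ℚ
  n*1/n≡1 = trans (QP.*-comm (ℕtoℚ n) (+ 1 ℚ./ n)) (1/n*n≡1 n)

ℕtoℚ-sum : ∀ k (F : Fin k → ℕ) → ℕtoℚ (sum F) ≡ ℚ∑.sum (ℕtoℚ ∘ F)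
ℕtoℚ-sum zero    F = refl
ℕtoℚ-sum (suc k) F = trans (ℕtoℚ-+ (F zero) (sum (F ∘ suc))) (cong (ℕtoℚ (F zero) +ℚ_) (ℕtoℚ-sum k (F ∘ suc)))

ℕtoℚ-sum-const : ∀ k (F : Fin k → ℕ) v → (∀ i → ℕtoℚ (F i) ≡ v) → ℕtoℚ (sum F) ≡ ℕtoℚ k *ℚ v
ℕtoℚ-sum-const zero    F v _       = sym (QP.*-zeroˡ v)
ℕtoℚ-sum-const (suc k) F v F≡v = begin
  ℕtoℚ (F zero + sum (F ∘ suc))          ≡⟨ ℕtoℚ-+ (F zero) (sum (F ∘ suc)) ⟩
  ℕtoℚ (F zero) +ℚ ℕtoℚ (sum (F ∘ suc))  ≡⟨ cong₂ _+ℚ_ (F≡v zero) (ℕtoℚ-sum-const k (F ∘ suc) v (F≡v ∘ suc)) ⟩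
  v +ℚ ℕtoℚ k *ℚ v                       ≡⟨ cong (_+ℚ ℕtoℚ k *ℚ v) (QP.*-identityˡ v) ⟨
  1ℚ *ℚ v +ℚ ℕtoℚ k *ℚ v                 ≡⟨ QP.*-distribʳ-+ v 1ℚ (ℕtoℚ k) ⟨
  (1ℚ +ℚ ℕtoℚ k) *ℚ v                    ≡⟨ cong (_*ℚ v) (ℕtoℚ-+ 1 k) ⟨
  ℕtoℚ (suc k) *ℚ v                      ∎
  where open ≡-Reasoning

ℕtoℚ-*-/ : ∀ b .{{_ : NonZero b}} p a → ℕtoℚ (b * p) *ℚ (+ a ℚ./ b) ≡ ℕtoℚ (p * a)
ℕtoℚ-*-/ b p a = begin
  ℕtoℚ (b * p) *ℚ (+ a ℚ./ b)                        ≡⟨ cong₂ _*ℚ_ (ℕtoℚ-* b p) (a/n≡a*1/n a b) ⟩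
  (ℕtoℚ b *ℚ ℕtoℚ p) *ℚ (ℕtoℚ a *ℚ (+ 1 ℚ./ b))
    ≡⟨ ℚ-Solver.solve 4 (λ b p a i → (b :* p) :* (a :* i) := (i :* b) :* (p :* a)) refl
         (ℕtoℚ b) (ℕtoℚ p) (ℕtoℚ a) (+ 1 ℚ./ b) ⟩
  ((+ 1 ℚ./ b) *ℚ ℕtoℚ b) *ℚ (ℕtoℚ p *ℚ ℕtoℚ a)     ≡⟨ cong (_*ℚ (ℕtoℚ p *ℚ ℕtoℚ a)) (1/n*n≡1 b) ⟩
  1ℚ *ℚ (ℕtoℚ p *ℚ ℕtoℚ a)                         ≡⟨ QP.*-identityˡ _ ⟩
  ℕtoℚ p *ℚ ℕtoℚ a                                 ≡⟨ ℕtoℚ-* p a ⟨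
  ℕtoℚ (p * a)                                     ∎
  where
  open ≡-Reasoning
  open ℚ-Solver using (_:*_; _:=_)

fallingFactorial : ℕ → ℕ → ℕ
fallingFactorial m zero    = 1
fallingFactorial m (suc k) = m * fallingFactorial (m ∸ 1) k

fallingFactorial-! : ∀ m k → k ≤ m → fallingFactorial m k * (m ∸ k) ! ≡ m !
fallingFactorial-! m       zero    _         = ℕP.+-identityʳ (m !)
fallingFactorial-! (suc m) (suc k) (s≤s k≤m) =
  trans (ℕP.*-assoc (suc m) (fallingFactorial m k) ((m ∸ k) !))
        (cong (suc m *_) (fallingFactorial-! m k k≤m))

module Coefficients (d' : ℕ) where

  private
    d : ℕ
    d = suc d'

  coeff-denominator : ℕ → ℕ
  coeff-denominator j = j ! * d ℕ.^ j

  coeff-denominator≢0 : ∀ j → NonZero (coeff-denominator j)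
  coeff-denominator≢0 j = ℕP.m*n≢0 (j !) (d ℕ.^ j) {{ℕP._!≢0 j}} {{ℕP.m^n≢0 d j}}

  coeff-inverse : ∀ j → coeff d j *ℚ ℕtoℚ (coeff-denominator j) ≡ 1ℚ
  coeff-inverse j = 1/n*n≡1 (coeff-denominator j) {{coeff-denominator≢0 j}}

  coeff-denominator-suc : ∀ j → coeff-denominator (suc j) ≡ suc j * d * coeff-denominator j
  coeff-denominator-suc j =
    solve 4 (λ a b c e → (a :* b) :* (c :* e) := (a :* c) :* (b :* e)) refl (suc j) (j !) d (d ℕ.^ j)
    where open ℕ-Solver

  coeff-step : ∀ j → coeff d j ≡ ℕtoℚ (suc j * d) *ℚ coeff d (suc j)
  coeff-step j = *-cancelʳ-ℕtoℚ (coeff-denominator j) {{coeff-denominator≢0 j}} _ _ (trans (coeff-inverse j) (sym (begin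
    ℕtoℚ (suc j * d) *ℚ coeff d (suc j) *ℚ ℕtoℚ (coeff-denominator j)
      ≡⟨ ℚ-Solver.solve 3 (λ a c D → a :* c :* D := (a :* D) :* c) refl
           (ℕtoℚ (suc j * d)) (coeff d (suc j)) (ℕtoℚ (coeff-denominator j)) ⟩
    (ℕtoℚ (suc j * d) *ℚ ℕtoℚ (coeff-denominator j)) *ℚ coeff d (suc j)
      ≡⟨ cong (_*ℚ coeff d (suc j)) (ℕtoℚ-* (suc j * d) (coeff-denominator j)) ⟨
    ℕtoℚ (suc j * d * coeff-denominator j) *ℚ coeff d (suc j)
      ≡⟨ cong (λ D → ℕtoℚ D *ℚ coeff d (suc j)) (coeff-denominator-suc j) ⟨
    ℕtoℚ (coeff-denominator (suc j)) *ℚ coeff d (suc j)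
      ≡⟨ QP.*-comm _ (coeff d (suc j)) ⟩
    coeff d (suc j) *ℚ ℕtoℚ (coeff-denominator (suc j))
      ≡⟨ coeff-inverse (suc j) ⟩
    1ℚ ∎)))
    where
    open ≡-Reasoning
    open ℚ-Solver using (_:*_; _:=_)

  at-table : ∀ i k → k ≤ i → at (table d i) k ≡ aSeq d (i ∸ k)
  at-table zero    zero    _         = refl
  at-table (suc i) zero    _         = refl
  at-table (suc i) (suc k) (s≤s k≤i) = at-table i k k≤i

  length-table : ∀ i → length (table d i) ≡ suc i
  length-table zero    = refl
  length-table (suc i) = cong suc (length-table i)

  sum-zipWith : ∀ (f : ℕ → ℚ → ℚ) n (h : ℕ → ℕ) (L : List ℚ) → n ≤ length L →
    ℚsum (zipWith f (map suc (applyUpTo h n)) L) ≡ ℚ∑.sum (λ (j : Fin n) → f (suc (h (toℕ j))) (at L (toℕ j)))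
  sum-zipWith f zero    h L       _         = refl
  sum-zipWith f (suc n) h (x ∷ L) (s≤s n≤L) = cong (f (suc (h 0)) x +ℚ_) (sum-zipWith f n (h ∘ suc) L n≤L)

  a≡∑b : ∀ i → aSeq d i ≡ ℚ∑.sum (λ (j : Fin i) → bSeq d i (suc (toℕ j)))
  a≡∑b zero    = refl
  a≡∑b (suc i) = trans
    (sum-zipWith (λ k x → (1ℚ - x) *ℚ coeff d k) (suc i) (λ z → z) (table d i)
                 (ℕP.≤-reflexive (sym (length-table i))))
    (ℚ∑.sum-cong-≗ λ j → cong (λ z → (1ℚ - z) *ℚ coeff d (suc (toℕ j)))
                            (at-table i (toℕ j) (ℕ.s≤s⁻¹ (FinP.toℕ<n j))))

-- Cycles of a fixed length d = suc d'

module _ {d' : ℕ} where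

  cyclicSuc : Fin (suc d') → Fin (suc d')
  cyclicSuc k with toℕ k ℕP.<? d'
  ... | yes k<d' = fromℕ< (s≤s k<d')
  ... | no _     = zero

  toℕ-cyclicSuc : ∀ k → toℕ k < d' → toℕ (cyclicSuc k) ≡ suc (toℕ k)
  toℕ-cyclicSuc k k<d' with toℕ k ℕP.<? d'
  ... | yes k<d'' = FinP.toℕ-fromℕ< (s≤s k<d'')
  ... | no k≮d'  = ⊥-elim (k≮d' k<d')

  cyclicSuc-last : ∀ k → toℕ k ≡ d' → cyclicSuc k ≡ zero
  cyclicSuc-last k k≡d' with toℕ k ℕP.<? d'
  ... | yes k<d' = ⊥-elim (ℕP.<-irrefl k≡d' k<d')
  ... | no _     = refl

  toℕ<⊎≡last : ∀ (k : Fin (suc d')) → toℕ k < d' ⊎ toℕ k ≡ d'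
  toℕ<⊎≡last k = ℕP.m≤n⇒m<n∨m≡n (ℕ.s≤s⁻¹ (FinP.toℕ<n k))

  cyclicSuc-injective : ∀ a b → cyclicSuc a ≡ cyclicSuc b → a ≡ b
  cyclicSuc-injective a b eq with toℕ<⊎≡last a | toℕ<⊎≡last b
  ... | inj₁ a<d' | inj₁ b<d' = FinP.toℕ-injective (ℕP.suc-injective
          (trans (sym (toℕ-cyclicSuc a a<d')) (trans (cong toℕ eq) (toℕ-cyclicSuc b b<d'))))
  ... | inj₁ a<d' | inj₂ b≡d' = ⊥-elim (ℕP.1+n≢0
          (trans (sym (toℕ-cyclicSuc a a<d')) (trans (cong toℕ eq) (cong toℕ (cyclicSuc-last b b≡d')))))
  ... | inj₂ a≡d' | inj₁ b<d' = ⊥-elim (ℕP.1+n≢0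
          (trans (sym (toℕ-cyclicSuc b b<d')) (trans (cong toℕ (sym eq)) (cong toℕ (cyclicSuc-last a a≡d')))))
  ... | inj₂ a≡d' | inj₂ b≡d' = FinP.toℕ-injective (trans a≡d' (sym b≡d'))

module Cycles (N d' : ℕ) where
  open Permutations N public

  d : ℕ
  d = suc d'

  infix 4 _∈ᵥ_ _∈ᵥ?_
  _∈ᵥ_ : ∀ {k} → Fin N → Vec (Fin N) k → Set
  y ∈ᵥ s = ∃ λ i → lookup s i ≡ y

  _∈ᵥ?_ : ∀ {k} y (s : Vec (Fin N) k) → Dec (y ∈ᵥ s)
  y ∈ᵥ? s = FinP.any? (λ i → lookup s i FinP.≟ y)

  Distinct : ∀ {k} → Vec (Fin N) k → Set
  Distinct s = ∀ i j → lookup s i ≡ lookup s j → i ≡ j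

  Arrangement : ∀ {k} → Subset → Vec (Fin N) k → Set
  Arrangement S s = (∀ i → lookup s i ∈ S) × Distinct s

  _∖_ : ∀ {k} → Subset → Vec (Fin N) k → Subset
  S ∖ s = minus S (_∈ᵥ? s)

  Distinct-HasCard : ∀ {k} (s : Vec (Fin N) k) → Distinct s → HasCard Finₛ (_∈ᵥ s) k
  Distinct-HasCard s s-distinct = lookup s , (λ i → i , refl) , s-distinct , λ { y (k , refl) → k , refl }

  ∣∖∣ : ∀ S (s : Vec (Fin N) d) → Arrangement S s → ∣ S ∣ ≡ ∣ S ∖ s ∣ + d
  ∣∖∣ S s (s⊆S , s-distinct) = ∣minus∣ S (_∈ᵥ? s) (Distinct-HasCard s s-distinct) λ { y (k , refl) → s⊆S k }

  abstract
    dPoints : Subset → Perm → ℕ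
    dPoints S g = proj₁ (HasCard-Fin-split N (λ y → y ∈ S × InDCycle d g y)
                                             (λ y → (y ∈? S) ×-dec InDCycle? d g y))

    dPoints-HasCard : ∀ S g → HasCard Finₛ (λ y → y ∈ S × InDCycle d g y) (dPoints S g)
    dPoints-HasCard S g = proj₁ (proj₂ (proj₂ (HasCard-Fin-split N (λ y → y ∈ S × InDCycle d g y)
                                                             (λ y → (y ∈? S) ×-dec InDCycle? d g y))))

  dPoints-resp : ∀ S {g h} → g ≗ₚ h → dPoints S g ≡ dPoints S h
  dPoints-resp S {g} {h} g≗h = HasCard-≡ Finₛ (dPoints-HasCard S g) (dPoints-HasCard S h)
    (λ y (y∈S , y∈C) → y∈S , InDCycle-resp d {g} {h} g≗h y y∈C)
    (λ y (y∈S , y∈C) → y∈S , InDCycle-resp d {h} {g} (λ z → sym (g≗h z)) y y∈C)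

  dPoints-≤ : ∀ S g → dPoints S g ≤ ∣ S ∣
  dPoints-≤ S g = HasCard-mono-≤ Finₛ (dPoints-HasCard S g) (∣∣-HasCard S) (λ _ → proj₁)

  orbit : Perm → Fin N → Vec (Fin N) d
  orbit g x = tabulate (λ k → g ^ toℕ k · x)

  lookup-orbit : ∀ g x k → lookup (orbit g x) k ≡ g ^ toℕ k · x
  lookup-orbit g x k = VecP.lookup∘tabulate (λ k → g ^ toℕ k · x) k

  orbit-cong : ∀ {g h} → g ≗ₚ h → ∀ x → orbit g x ≡ orbit h x
  orbit-cong {g} {h} g≗h x = VecP.tabulate-cong (λ k → ^-cong {g} {h} g≗h (toℕ k) x)

  keepOutside : ∀ {k} (s : Vec (Fin N) k) → Perm → ∀ y → Dec (y ∈ᵥ s) → Fin N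
  keepOutside s g y (yes _) = y
  keepOutside s g y (no _)  = g · y

  removeCycleᶠ : Perm → Fin N → Fin N → Fin N
  removeCycleᶠ g x y = keepOutside (orbit g x) g y (y ∈ᵥ? orbit g x)

  removeCycle : Perm → Fin N → Perm
  removeCycle g x = permutationOf (removeCycleᶠ g x)

  closeCycle : (s : Vec (Fin N) d) → Perm → ∀ y → Dec (y ∈ᵥ s) → Fin N
  closeCycle s h y (yes (k , _)) = lookup s (cyclicSuc k)
  closeCycle s h y (no _)        = h · y

  addCycleᶠ : Vec (Fin N) d → Perm → Fin N → Fin N
  addCycleᶠ s h y = closeCycle s h y (y ∈ᵥ? s)

  addCycle : Vec (Fin N) d → Perm → Perm
  addCycle s h = permutationOf (addCycleᶠ s h)

  module Orbit (g : Perm) (x : Fin N) (x∈C : InDCycle d g x) where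

    o : Vec (Fin N) d
    o = orbit g x

    orbit-step : ∀ k → g · lookup o k ≡ lookup o (cyclicSuc k)
    orbit-step k with toℕ<⊎≡last k
    ... | inj₁ k<d' = begin
      g · lookup o k                 ≡⟨ cong (g ·_) (lookup-orbit g x k) ⟩
      g ^ suc (toℕ k) · x            ≡⟨ cong (g ^_· x) (toℕ-cyclicSuc k k<d') ⟨
      g ^ toℕ (cyclicSuc k) · x      ≡⟨ lookup-orbit g x (cyclicSuc k) ⟨
      lookup o (cyclicSuc k)         ∎
      where open ≡-Reasoning
    ... | inj₂ k≡d' = begin
      g · lookup o k                 ≡⟨ cong (g ·_) (lookup-orbit g x k) ⟩
      g ^ suc (toℕ k) · x            ≡⟨ cong (λ m → g ^ suc m · x) k≡d' ⟩
      g ^ d · x                      ≡⟨ proj₁ x∈C ⟩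
      lookup o zero                  ≡⟨ cong (lookup o) (cyclicSuc-last k k≡d') ⟨
      lookup o (cyclicSuc k)         ∎
      where open ≡-Reasoning

    iterate-distinct : ∀ a b → a < b → b < d → g ^ a · x ≢ g ^ b · x
    iterate-distinct a b a<b b<d eq = proj₂ x∈C (b ∸ a) (ℕP.m<n⇒0<n∸m a<b)
      (ℕP.≤-trans (s≤s (ℕP.m∸n≤m b a)) b<d)
      (^-injective g a _ _ (begin
        g ^ a · (g ^ (b ∸ a) · x)   ≡⟨ iter-+ (g ⟨$⟩ʳ_) a (b ∸ a) x ⟨
        g ^ (a + (b ∸ a)) · x       ≡⟨ cong (g ^_· x) (ℕP.m+[n∸m]≡n (ℕP.<⇒≤ a<b)) ⟩
        g ^ b · x                   ≡⟨ eq ⟨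
        g ^ a · x                   ∎))
      where open ≡-Reasoning

    orbit-distinct : Distinct o
    orbit-distinct i j eq with ℕP.<-cmp (toℕ i) (toℕ j)
    ... | tri≈ _ i≡j _ = FinP.toℕ-injective i≡j
    ... | tri< i<j _ _ = ⊥-elim (iterate-distinct _ _ i<j (FinP.toℕ<n j)
            (trans (sym (lookup-orbit g x i)) (trans eq (lookup-orbit g x j))))
    ... | tri> _ _ j<i = ⊥-elim (iterate-distinct _ _ j<i (FinP.toℕ<n i)
            (trans (sym (lookup-orbit g x j)) (trans (sym eq) (lookup-orbit g x i))))

    orbit-InDCycle : ∀ k → InDCycle d g (lookup o k)
    orbit-InDCycle k rewrite lookup-orbit g x k =
      trans (iter-comm (g ⟨$⟩ʳ_) d (toℕ k) x) (cong (g ^ toℕ k ·_) (proj₁ x∈C)) ,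
      λ m 0<m m<d eq → proj₂ x∈C m 0<m m<d
        (^-injective g (toℕ k) _ _ (trans (iter-comm (g ⟨$⟩ʳ_) (toℕ k) m x) eq))

    ∈orbit-preimage : ∀ y k → g · y ≡ lookup o k → y ∈ᵥ o
    ∈orbit-preimage y k eq with injective⇒surjective cyclicSuc cyclicSuc-injective k
    ... | j , refl = j , ·-injective g _ _ (trans (orbit-step j) (sym eq))

    iterate∈orbit : ∀ m → g ^ m · x ∈ᵥ o
    iterate∈orbit zero = zero , refl
    iterate∈orbit (suc m) with iterate∈orbit m
    ... | k , eq = cyclicSuc k , trans (sym (orbit-step k)) (cong (g ·_) eq)

    ∉orbit-step : ∀ y → ¬ y ∈ᵥ o → ¬ g · y ∈ᵥ o
    ∉orbit-step y y∉o (k , eq) = y∉o (∈orbit-preimage y k (sym eq))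

    removeCycleᶠ-∈ : ∀ y → y ∈ᵥ o → removeCycleᶠ g x y ≡ y
    removeCycleᶠ-∈ y y∈o with y ∈ᵥ? o
    ... | yes _   = refl
    ... | no y∉o = ⊥-elim (y∉o y∈o)

    removeCycleᶠ-∉ : ∀ y → ¬ y ∈ᵥ o → removeCycleᶠ g x y ≡ g · y
    removeCycleᶠ-∉ y y∉o with y ∈ᵥ? o
    ... | yes y∈o = ⊥-elim (y∉o y∈o)
    ... | no _    = refl

    removeCycleᶠ-injective : ∀ a b → removeCycleᶠ g x a ≡ removeCycleᶠ g x b → a ≡ b
    removeCycleᶠ-injective a b eq with a ∈ᵥ? o | b ∈ᵥ? o
    ... | yes _   | yes _   = eq
    ... | yes a∈o | no b∉o = ⊥-elim (∉orbit-step b b∉o (subst (_∈ᵥ o) eq a∈o))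
    ... | no a∉o | yes b∈o = ⊥-elim (∉orbit-step a a∉o (subst (_∈ᵥ o) (sym eq) b∈o))
    ... | no _    | no _    = ·-injective g a b eq

    rest : Perm
    rest = removeCycle g x

    rest-· : ∀ y → rest · y ≡ removeCycleᶠ g x y
    rest-· = permutationOf-· (removeCycleᶠ g x) removeCycleᶠ-injective

    rest-iterate : ∀ y → ¬ y ∈ᵥ o → ∀ m → ¬ g ^ m · y ∈ᵥ o × rest ^ m · y ≡ g ^ m · y
    rest-iterate y y∉o zero = y∉o , refl
    rest-iterate y y∉o (suc m) with rest-iterate y y∉o m
    ... | gᵐy∉o , eq = ∉orbit-step _ gᵐy∉o ,
                       trans (cong (rest ·_) eq) (trans (rest-· _) (removeCycleᶠ-∉ _ gᵐy∉o))

    InDCycle-rest : ∀ y → ¬ y ∈ᵥ o → InDCycle d g y → InDCycle d rest y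
    InDCycle-rest y y∉o (closes , minimal) =
      trans (proj₂ (rest-iterate y y∉o d)) closes ,
      λ m 0<m m<d eq → minimal m 0<m m<d (trans (sym (proj₂ (rest-iterate y y∉o m))) eq)

    InDCycle-rest⁻ : ∀ y → ¬ y ∈ᵥ o → InDCycle d rest y → InDCycle d g y
    InDCycle-rest⁻ y y∉o (closes , minimal) =
      trans (sym (proj₂ (rest-iterate y y∉o d))) closes ,
      λ m 0<m m<d eq → minimal m 0<m m<d (trans (proj₂ (rest-iterate y y∉o m)) eq)

    module Supported (S : Subset) (g∈Sym : Sym S g) (x∈S : x ∈ S) where

      iterate∈S : ∀ m → g ^ m · x ∈ S
      iterate∈S zero    = x∈S
      iterate∈S (suc m) = Sym-closed {S} {g} g∈Sym (iterate∈S m)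

      orbit-Arrangement : Arrangement S o
      orbit-Arrangement = (λ k → subst (_∈ S) (sym (lookup-orbit g x k)) (iterate∈S (toℕ k))) ,
                          orbit-distinct

      rest-Sym : Sym (S ∖ o) rest
      rest-Sym y y∉S∖o with y ∈ᵥ? o
      ... | yes y∈o = trans (rest-· y) (removeCycleᶠ-∈ y y∈o)
      ... | no y∉o  = trans (rest-· y) (trans (removeCycleᶠ-∉ y y∉o)
                        (g∈Sym y λ y∈S → y∉S∖o (∈-minus⁺ S (_∈ᵥ? o) y∈S y∉o)))

      dPoints-removeCycle : dPoints S g ≡ dPoints (S ∖ o) rest + d
      dPoints-removeCycle = HasCard-≡ Finₛ (dPoints-HasCard S g)
        (HasCard-⊎ Finₛ (dPoints-HasCard (S ∖ o) rest) (Distinct-HasCard o orbit-distinct)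
          (λ a b (a∈ , _) b∈o a≡b → proj₂ (∈-minus⁻ S (_∈ᵥ? o) a∈) (subst (_∈ᵥ o) (sym a≡b) b∈o)))
        split join
        where
        split : ∀ y → y ∈ S × InDCycle d g y → (y ∈ S ∖ o × InDCycle d rest y) ⊎ y ∈ᵥ o
        split y (y∈S , y∈C) with y ∈ᵥ? o
        ... | yes y∈o = inj₂ y∈o
        ... | no y∉o  = inj₁ (∈-minus⁺ S (_∈ᵥ? o) y∈S y∉o , InDCycle-rest y y∉o y∈C)
        join : ∀ y → (y ∈ S ∖ o × InDCycle d rest y) ⊎ y ∈ᵥ o → y ∈ S × InDCycle d g y
        join y (inj₁ (y∈ , y∈C)) = let (y∈S , y∉o) = ∈-minus⁻ S (_∈ᵥ? o) y∈ in
                                   y∈S , InDCycle-rest⁻ y y∉o y∈C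
        join y (inj₂ (k , refl)) = proj₁ orbit-Arrangement k , orbit-InDCycle k

      single-cycle : dPoints S g ≡ d → ∀ y → y ∈ S → ¬ y ∈ᵥ o → ¬ InDCycle d g y
      single-cycle dPoints≡d y y∈S y∉o y∈C = HasCard-0⇒∅ Finₛ
        (subst (HasCard Finₛ _) dPoints-rest≡0 (dPoints-HasCard (S ∖ o) rest)) y
        (∈-minus⁺ S (_∈ᵥ? o) y∈S y∉o , InDCycle-rest y y∉o y∈C)
        where
        dPoints-rest≡0 : dPoints (S ∖ o) rest ≡ 0
        dPoints-rest≡0 = ℕP.+-cancelʳ-≡ d _ 0 (trans (sym dPoints-removeCycle) dPoints≡d)

  module AddCycle (s : Vec (Fin N) d) (s-distinct : Distinct s) (h : Perm)
                  (h-fixes-s : ∀ k → h · lookup s k ≡ lookup s k) where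

    addCycleᶠ-∈ : ∀ k → addCycleᶠ s h (lookup s k) ≡ lookup s (cyclicSuc k)
    addCycleᶠ-∈ k with lookup s k ∈ᵥ? s
    ... | yes (k' , eq) = cong (lookup s ∘ cyclicSuc) (s-distinct k' k eq)
    ... | no ∉s         = ⊥-elim (∉s (k , refl))

    addCycleᶠ-∉ : ∀ y → ¬ y ∈ᵥ s → addCycleᶠ s h y ≡ h · y
    addCycleᶠ-∉ y y∉s with y ∈ᵥ? s
    ... | yes y∈s = ⊥-elim (y∉s y∈s)
    ... | no _    = refl

    addCycleᶠ-injective : ∀ a b → addCycleᶠ s h a ≡ addCycleᶠ s h b → a ≡ b
    addCycleᶠ-injective a b eq with a ∈ᵥ? s | b ∈ᵥ? s
    ... | yes (i , refl) | yes (j , refl) =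
      cong (lookup s) (cyclicSuc-injective i j (s-distinct _ _ eq))
    ... | yes (i , _) | no b∉s =
      ⊥-elim (b∉s (cyclicSuc i , sym (·-injective h _ _ (trans (sym eq) (sym (h-fixes-s (cyclicSuc i)))))))
    ... | no a∉s | yes (j , _) =
      ⊥-elim (a∉s (cyclicSuc j , sym (·-injective h _ _ (trans eq (sym (h-fixes-s (cyclicSuc j)))))))
    ... | no _ | no _ = ·-injective h a b eq

    g : Perm
    g = addCycle s h

    g-· : ∀ y → g · y ≡ addCycleᶠ s h y
    g-· = permutationOf-· (addCycleᶠ s h) addCycleᶠ-injective

    g-iterate : ∀ m (m<d : m < d) → g ^ m · lookup s zero ≡ lookup s (fromℕ< m<d)
    g-iterate zero    m<d = refl
    g-iterate (suc m) m<d = begin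
      g · (g ^ m · lookup s zero)          ≡⟨ cong (g ·_) (g-iterate m (ℕP.<-trans (ℕP.n<1+n m) m<d)) ⟩
      g · lookup s (fromℕ< _)              ≡⟨ trans (g-· _) (addCycleᶠ-∈ _) ⟩
      lookup s (cyclicSuc (fromℕ< _))      ≡⟨ cong (lookup s) (FinP.toℕ-injective toℕ-eq) ⟩
      lookup s (fromℕ< m<d)                ∎
      where
      open ≡-Reasoning
      m<d' : m < d
      m<d' = ℕP.<-trans (ℕP.n<1+n m) m<d
      toℕ-eq : toℕ (cyclicSuc (fromℕ< m<d')) ≡ toℕ (fromℕ< m<d)
      toℕ-eq = begin
        toℕ (cyclicSuc (fromℕ< m<d'))  ≡⟨ toℕ-cyclicSuc _ (subst (_< d') (sym (FinP.toℕ-fromℕ< _)) (ℕ.s<s⁻¹ m<d)) ⟩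
        suc (toℕ (fromℕ< m<d'))        ≡⟨ cong suc (FinP.toℕ-fromℕ< m<d') ⟩
        suc m                          ≡⟨ FinP.toℕ-fromℕ< m<d ⟨
        toℕ (fromℕ< m<d)               ∎

    orbit-addCycle : orbit g (lookup s zero) ≡ s
    orbit-addCycle = trans (VecP.tabulate-cong λ k →
        trans (g-iterate (toℕ k) (FinP.toℕ<n k)) (cong (lookup s) (FinP.fromℕ<-toℕ k (FinP.toℕ<n k))))
      (VecP.tabulate∘lookup s)

    addCycle-InDCycle : InDCycle d g (lookup s zero)
    addCycle-InDCycle =
      trans (cong (g ·_) (g-iterate d' (ℕP.n<1+n d')))
        (trans (g-· _) (trans (addCycleᶠ-∈ _) (cong (lookup s) (cyclicSuc-last _ (FinP.toℕ-fromℕ< _))))) ,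
      λ m 0<m m<d eq → ℕP.<-irrefl (sym (trans (sym (FinP.toℕ-fromℕ< m<d))
        (cong toℕ (s-distinct _ _ (trans (sym (g-iterate m m<d)) eq))))) 0<m

  Pair : Set
  Pair = Vec (Fin N) d × Perm

  pairₛ : Setoid 0ℓ 0ℓ
  pairₛ = ×-setoid (setoid (Vec (Fin N) d)) permSetoid

  cut : Fin N → Perm → Pair
  cut x g = orbit g x , removeCycle g x

  glue : Pair → Perm
  glue (s , h) = addCycle s h

  cut-cong : ∀ x {g g'} → g ≗ₚ g' → Setoid._≈_ pairₛ (cut x g) (cut x g')
  cut-cong x {g} {g'} g≗g' =
    orbit-cong {g} {g'} g≗g' x ,
    permutationOf-cong (removeCycleᶠ g x) (removeCycleᶠ g' x) λ y →
      trans (keepOutside-cong (orbit g x) y (y ∈ᵥ? orbit g x))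
            (cong (λ o → keepOutside o g' y (y ∈ᵥ? o)) (orbit-cong {g} {g'} g≗g' x))
    where
    keepOutside-cong : ∀ {k} (o : Vec (Fin N) k) y y∈? → keepOutside o g y y∈? ≡ keepOutside o g' y y∈?
    keepOutside-cong o y (yes _) = refl
    keepOutside-cong o y (no _)  = g≗g' y

  glue-cong : ∀ {p p'} → Setoid._≈_ pairₛ p p' → glue p ≗ₚ glue p'
  glue-cong {s , h} {.s , h'} (refl , h≗h') =
    permutationOf-cong (addCycleᶠ s h) (addCycleᶠ s h') λ y → closeCycle-cong y (y ∈ᵥ? s)
    where
    closeCycle-cong : ∀ y y∈? → closeCycle s h y y∈? ≡ closeCycle s h' y y∈?
    closeCycle-cong y (yes _) = refl
    closeCycle-cong y (no _)  = h≗h' y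

  -- Cutting the d-cycle through x out of a permutation of S is a bijection onto
  -- arrangements of that cycle starting at x, paired with a permutation of the rest.
  module Cutting (S : Subset) (x : Fin N) (x∈S : x ∈ S) (c : ℕ) where

    Rooted : Perm → Set
    Rooted g = Sym S g × dPoints S g ≡ c × InDCycle d g x

    Cut : Pair → Set
    Cut (s , h) = Arrangement S s × lookup s zero ≡ x × Sym (S ∖ s) h × dPoints (S ∖ s) h + d ≡ c

    cut-Cut : ∀ g → Rooted g → Cut (cut x g)
    cut-Cut g (g∈Sym , dPoints≡c , x∈C) =
      orbit-Arrangement , refl , rest-Sym , trans (sym dPoints-removeCycle) dPoints≡c
      where
      open Orbit g x x∈C
      open Supported S g∈Sym x∈S

    glue-cut : ∀ g → Rooted g → glue (cut x g) ≗ₚ g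
    glue-cut g (_ , _ , x∈C) y = trans (AddCycle.g-· o orbit-distinct rest rest-fixes-o y) (by-cases (y ∈ᵥ? o))
      where
      open Orbit g x x∈C
      rest-fixes-o : ∀ k → rest · lookup o k ≡ lookup o k
      rest-fixes-o k = trans (rest-· _) (removeCycleᶠ-∈ _ (k , refl))
      by-cases : (y∈? : Dec (y ∈ᵥ o)) → addCycleᶠ o rest y ≡ g · y
      by-cases (yes (k , refl)) = trans (AddCycle.addCycleᶠ-∈ o orbit-distinct rest rest-fixes-o k)
                                        (sym (orbit-step k))
      by-cases (no y∉o) = trans (AddCycle.addCycleᶠ-∉ o orbit-distinct rest rest-fixes-o y y∉o)
                                (trans (rest-· y) (removeCycleᶠ-∉ y y∉o))

    module FromCut (s : Vec (Fin N) d) (h : Perm) (p-cut : Cut (s , h)) where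

      s-arr : Arrangement S s
      s-arr = proj₁ p-cut
      s₀≡x : lookup s zero ≡ x
      s₀≡x = proj₁ (proj₂ p-cut)
      h∈Sym : Sym (S ∖ s) h
      h∈Sym = proj₁ (proj₂ (proj₂ p-cut))
      dPoints≡c : dPoints (S ∖ s) h + d ≡ c
      dPoints≡c = proj₂ (proj₂ (proj₂ p-cut))

      h-fixes-s : ∀ k → h · lookup s k ≡ lookup s k
      h-fixes-s k = h∈Sym _ λ sk∈ → proj₂ (∈-minus⁻ S (_∈ᵥ? s) sk∈) (k , refl)

      open AddCycle s (proj₂ s-arr) h h-fixes-s

      g-InDCycle : InDCycle d g x
      g-InDCycle = subst (InDCycle d g) s₀≡x addCycle-InDCycle

      orbit-g : orbit g x ≡ s
      orbit-g = subst (λ z → orbit g z ≡ s) s₀≡x orbit-addCycle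

      g-Sym : Sym S g
      g-Sym y y∉S = trans (g-· y) (trans (addCycleᶠ-∉ y y∉s)
                      (h∈Sym y λ y∈ → y∉S (proj₁ (∈-minus⁻ S (_∈ᵥ? s) y∈))))
        where
        y∉s : ¬ y ∈ᵥ s
        y∉s (k , refl) = y∉S (proj₁ s-arr k)

      removeCycle-g : removeCycle g x ≗ₚ h
      removeCycle-g y = trans (Orbit.rest-· g x g-InDCycle y) (by-cases (y ∈ᵥ? orbit g x))
        where
        by-cases : (y∈? : Dec (y ∈ᵥ orbit g x)) → keepOutside (orbit g x) g y y∈? ≡ h · y
        by-cases (yes y∈o) with subst (y ∈ᵥ_) orbit-g y∈o
        ... | k , refl = sym (h-fixes-s k)
        by-cases (no y∉o) = trans (g-· y) (addCycleᶠ-∉ y (y∉o ∘ subst (y ∈ᵥ_) (sym orbit-g)))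

      dPoints-g : dPoints S g ≡ c
      dPoints-g = begin
        dPoints S g                              ≡⟨ Supported.dPoints-removeCycle S g-Sym x∈S ⟩
        dPoints (S ∖ orbit g x) (removeCycle g x) + d
          ≡⟨ cong (λ o → dPoints (S ∖ o) (removeCycle g x) + d) orbit-g ⟩
        dPoints (S ∖ s) (removeCycle g x) + d    ≡⟨ cong (_+ d) (dPoints-resp (S ∖ s) {removeCycle g x} {h} removeCycle-g) ⟩
        dPoints (S ∖ s) h + d                    ≡⟨ dPoints≡c ⟩
        c                                        ∎
        where
        open ≡-Reasoning
        open Orbit g x g-InDCycle

    glue-Rooted : ∀ p → Cut p → Rooted (glue p)
    glue-Rooted (s , h) p-cut = g-Sym , dPoints-g , g-InDCycle
      where open FromCut s h p-cut

    cut-glue : ∀ p → Cut p → Setoid._≈_ pairₛ p (cut x (glue p))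
    cut-glue (s , h) p-cut = sym orbit-g , λ y → sym (removeCycle-g y)
      where open FromCut s h p-cut

    Rooted-HasCard : (Q : Perm → Set) (R : Pair → Set) →
      (∀ p p' → Setoid._≈_ pairₛ p p' → R p → R p') →
      (∀ g → Rooted g → Q g → R (cut x g)) →
      (∀ g → Rooted g → R (cut x g) → Q g) →
      ∀ {k} → HasCard pairₛ (λ p → Cut p × R p) k → HasCard permSetoid (λ g → Rooted g × Q g) k
    Rooted-HasCard Q R R-resp Q⇒R R⇒Q pairs = HasCard-bijection pairₛ permSetoid pairs glue
      (λ p (p-cut , r) → glue-Rooted p p-cut ,
                         R⇒Q (glue p) (glue-Rooted p p-cut) (R-resp _ _ (cut-glue p p-cut) r))
      (λ p p' (p-cut , _) (p'-cut , _) eq →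
         ≈-trans {p} {cut x (glue p)} {p'} (cut-glue p p-cut)
           (≈-trans {cut x (glue p)} {cut x (glue p')} {p'} (cut-cong x {glue p} {glue p'} eq)
              (≈-sym {p'} {cut x (glue p')} (cut-glue p' p'-cut))))
      (λ p p' _ eq → glue-cong {p} {p'} eq)
      (λ g (g-rooted , q) → cut x g , (cut-Cut g g-rooted , Q⇒R g g-rooted q) ,
                            λ y → sym (glue-cut g g-rooted y))
      where open Setoid pairₛ using () renaming (sym to ≈-sym; trans to ≈-trans)

  Vecₛ : ℕ → Setoid 0ℓ 0ℓ
  Vecₛ k = setoid (Vec (Fin N) k)

  ∣─∣-∸ : ∀ {S y m} → y ∈ S → ∣ S ∣ ≡ m → ∣ S ─ y ∣ ≡ m ∸ 1
  ∣─∣-∸ y∈S ∣S∣≡m = trans (sym (cong (_∸ 1) (∣─∣ y∈S))) (cong (_∸ 1) ∣S∣≡m)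

  ∣∖∣-∸ : ∀ S s {m} → Arrangement S s → ∣ S ∣ ≡ m → ∣ S ∖ s ∣ ≡ m ∸ d
  ∣∖∣-∸ S s s-arr ∣S∣≡m =
    trans (sym (ℕP.m+n∸n≡m ∣ S ∖ s ∣ d)) (cong (_∸ d) (trans (sym (∣∖∣ S s s-arr)) ∣S∣≡m))

  Arrangement-∷⁻ : ∀ {k S y} {t : Vec (Fin N) k} → Arrangement S (y ∷ t) → y ∈ S × Arrangement (S ─ y) t
  Arrangement-∷⁻ {S = S} {y} (t⊆S , distinct) = t⊆S zero ,
    (λ i → ∈-minus⁺ S (FinP._≟ y) (t⊆S (suc i)) λ eq → FinP.0≢1+n (sym (distinct (suc i) zero eq))) ,
    (λ i j eq → FinP.suc-injective (distinct (suc i) (suc j) eq))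

  Arrangement-∷⁺ : ∀ {k S y} {t : Vec (Fin N) k} → y ∈ S → Arrangement (S ─ y) t → Arrangement S (y ∷ t)
  Arrangement-∷⁺ {S = S} {y} {t} y∈S (t⊆S─y , distinct) = ∷⊆S , ∷-distinct
    where
    ∷⊆S : ∀ i → lookup (y ∷ t) i ∈ S
    ∷⊆S zero    = y∈S
    ∷⊆S (suc i) = proj₁ (∈-minus⁻ S (FinP._≟ y) (t⊆S─y i))
    ∷-distinct : Distinct (y ∷ t)
    ∷-distinct zero    zero    _  = refl
    ∷-distinct zero    (suc j) eq = ⊥-elim (proj₂ (∈-minus⁻ S (FinP._≟ y) (t⊆S─y j)) (sym eq))
    ∷-distinct (suc i) zero    eq = ⊥-elim (proj₂ (∈-minus⁻ S (FinP._≟ y) (t⊆S─y i)) eq)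
    ∷-distinct (suc i) (suc j) eq = cong suc (distinct i j eq)

  Arrangement-─⁻ : ∀ {k} S y (s : Vec (Fin N) k) → Arrangement (S ─ y) s → Arrangement S s × ¬ y ∈ᵥ s
  Arrangement-─⁻ S y s (s⊆S─y , distinct) =
    ((λ i → proj₁ (∈-minus⁻ S (FinP._≟ y) (s⊆S─y i))) , distinct) ,
    λ (i , eq) → proj₂ (∈-minus⁻ S (FinP._≟ y) (s⊆S─y i)) eq

  Arrangement-─⁺ : ∀ {k} S y (s : Vec (Fin N) k) → Arrangement S s → ¬ y ∈ᵥ s → Arrangement (S ─ y) s
  Arrangement-─⁺ S y s (s⊆S , distinct) y∉s =
    (λ i → ∈-minus⁺ S (FinP._≟ y) (s⊆S i) λ eq → y∉s (i , eq)) , distinct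

  Arrangement-HasCard : ∀ k m S → ∣ S ∣ ≡ m → HasCard (Vecₛ k) (Arrangement S) (fallingFactorial m k)
  Arrangement-HasCard zero m S _ = HasCard-resp (Vecₛ 0) (HasCard-singleton (Vecₛ 0) [])
    (λ { [] refl → (λ ()) , (λ ()) }) (λ { [] _ → refl })
  Arrangement-HasCard (suc k) m S ∣S∣≡m =
    subst (HasCard (Vecₛ (suc k)) (Arrangement S)) (sum-const m (fallingFactorial (m ∸ 1) k))
      (HasCard-resp (Vecₛ (suc k)) by-head
        (λ { _ (i , t , refl , t-arr) → Arrangement-∷⁺ {S = S} (S-elem∈S i) t-arr })
        (λ { (y ∷ t) yt-arr → let (y∈S , t-arr) = Arrangement-∷⁻ {S = S} yt-arr ; (i , y≡) = S-cover y y∈S in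
               i , t , cong (_∷ t) y≡ , subst (λ z → Arrangement (S ─ z) t) y≡ t-arr }))
    where
    S-card : HasCard Finₛ (_∈ S) m
    S-card = subst (HasCard Finₛ (_∈ S)) ∣S∣≡m (∣∣-HasCard S)
    S-elem : Fin m → Fin N
    S-elem = proj₁ S-card
    S-elem∈S : ∀ i → S-elem i ∈ S
    S-elem∈S = proj₁ (proj₂ S-card)
    S-cover : ∀ y → y ∈ S → ∃ λ i → y ≡ S-elem i
    S-cover = proj₂ (proj₂ (proj₂ S-card))
    Starting : Fin m → Vec (Fin N) (suc k) → Set
    Starting i v = ∃ λ t → v ≡ S-elem i ∷ t × Arrangement (S ─ S-elem i) t
    by-head : HasCard (Vecₛ (suc k)) (λ v → ∃ λ i → Starting i v) (sum {m} λ _ → fallingFactorial (m ∸ 1) k)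
    by-head = HasCard-∑ (Vecₛ (suc k)) m (λ _ → fallingFactorial (m ∸ 1) k) Starting
      (λ i → HasCard-bijection (Vecₛ k) (Vecₛ (suc k))
         (Arrangement-HasCard k (m ∸ 1) (S ─ S-elem i) (∣─∣-∸ (S-elem∈S i) ∣S∣≡m))
         (S-elem i ∷_) (λ t t-arr → t , refl , t-arr) (λ _ _ _ _ → VecP.∷-injectiveʳ)
         (λ { t .t _ refl → refl }) (λ { _ (t , refl , t-arr) → t , t-arr , refl }))
      (λ { i i' v .v (t , refl , _) (t' , eq , _) refl → proj₁ (proj₂ (proj₂ S-card)) i i' (VecP.∷-injectiveˡ eq) })

  Arrangement-from-HasCard : ∀ {S x m} → x ∈ S → ∣ S ∣ ≡ suc m →
    HasCard (Vecₛ d) (λ s → Arrangement S s × lookup s zero ≡ x) (fallingFactorial m d')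
  Arrangement-from-HasCard {S} {x} {m} x∈S ∣S∣≡1+m =
    HasCard-bijection (Vecₛ d') (Vecₛ d) (Arrangement-HasCard d' m (S ─ x) (∣─∣-∸ x∈S ∣S∣≡1+m))
      (x ∷_) (λ t t-arr → Arrangement-∷⁺ {S = S} x∈S t-arr , refl) (λ _ _ _ _ → VecP.∷-injectiveʳ)
      (λ { t .t _ refl → refl })
      (λ { (y ∷ t) (yt-arr , refl) → t , proj₂ (Arrangement-∷⁻ {S = S} yt-arr) , refl })

  WithDPoints : Subset → ℕ → Perm → Set
  WithDPoints S c g = Sym S g × dPoints S g ≡ c

  WithDPoints-resp : ∀ S c {g h} → g ≗ₚ h → WithDPoints S c g → WithDPoints S c h
  WithDPoints-resp S c {g} {h} g≗h (g∈Sym , dPoints≡c) =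
    Sym-resp S {g} {h} g≗h g∈Sym , trans (sym (dPoints-resp S {g} {h} g≗h)) dPoints≡c

  abstract
    count-split : ∀ S c → Σ ℕ λ k₁ → Σ ℕ λ k₂ →
      HasCard permSetoid (WithDPoints S c) k₁ ×
      HasCard permSetoid (λ g → Sym S g × dPoints S g ≢ c) k₂ × k₁ + k₂ ≡ ∣ S ∣ !
    count-split S c = HasCard-split permSetoid (Sym-HasCard ∣ S ∣ S refl) (λ g → dPoints S g ≡ c)
      (λ g → dPoints S g ℕP.≟ c) (λ g h g≗h → trans (sym (dPoints-resp S {g} {h} g≗h)))

    count : Subset → ℕ → ℕ
    count S c = proj₁ (count-split S c)

    count-HasCard : ∀ S c → HasCard permSetoid (WithDPoints S c) (count S c)
    count-HasCard S c = proj₁ (proj₂ (proj₂ (count-split S c)))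

    count-complement : ∀ S c → Σ ℕ λ k →
      HasCard permSetoid (λ g → Sym S g × dPoints S g ≢ c) k × count S c + k ≡ ∣ S ∣ !
    count-complement S c = let (_ , k , _ , c̅ , sum≡) = count-split S c in k , c̅ , sum≡

  -- Double counting of the pairs (g, y) with y a point of S on a d-cycle of g.
  count*c≡∑ : ∀ S c (F : Fin ∣ S ∣ → ℕ) →
    (∀ i → HasCard permSetoid (λ g → WithDPoints S c g × InDCycle d g (proj₁ (∣∣-HasCard S) i)) (F i)) →
    count S c * c ≡ sum F
  count*c≡∑ S c F fibre = trans (sym (sum-const (count S c) c)) (HasCard-≡ (×-setoid permSetoid Finₛ) by-g by-y
      (λ (g , y) (g∈ , y∈S , y∈C) → y∈S , g∈ , y∈C) (λ (g , y) (y∈S , g∈ , y∈C) → g∈ , y∈S , y∈C))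
    where
    by-g : HasCard (×-setoid permSetoid Finₛ) (λ (g , y) → WithDPoints S c g × y ∈ S × InDCycle d g y)
                   (sum {count S c} λ _ → c)
    by-g = HasCard-Σ permSetoid Finₛ (count-HasCard S c) (λ _ → c)
      (λ i → subst (HasCard Finₛ _) (proj₂ (proj₁ (proj₂ (count-HasCard S c)) i))
                   (dPoints-HasCard S (proj₁ (count-HasCard S c) i)))
      (λ g h g≗h → WithDPoints-resp S c {g} {h} g≗h)
      (λ g h y g≗h (y∈S , y∈C) → y∈S , InDCycle-resp d {g} {h} g≗h y y∈C)
    by-y : HasCard (×-setoid permSetoid Finₛ) (λ (g , y) → y ∈ S × WithDPoints S c g × InDCycle d g y) (sum F)
    by-y = HasCard-bijection (×-setoid Finₛ permSetoid) (×-setoid permSetoid Finₛ)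
      (HasCard-Σ Finₛ permSetoid {R = λ y g → WithDPoints S c g × InDCycle d g y} (∣∣-HasCard S) F fibre
         (λ { y .y refl y∈S → y∈S }) (λ { y .y g refl p → p }))
      (λ (y , g) → g , y) (λ _ p → p) (λ _ _ _ _ (g≗g' , y≡y') → y≡y' , g≗g')
      (λ _ _ _ (y≡y' , g≗g') → g≗g' , y≡y') (λ (g , y) p → (y , g) , p , (λ _ → refl) , refl)

  d∣dPoints : ∀ m S → ∣ S ∣ ≡ m → ∀ g → Sym S g → d ∣ dPoints S g
  d∣dPoints = <-rec (λ m → ∀ S → ∣ S ∣ ≡ m → ∀ g → Sym S g → d ∣ dPoints S g) step
    where
    step : ∀ m → (∀ {m'} → m' < m → ∀ S → ∣ S ∣ ≡ m' → ∀ g → Sym S g → d ∣ dPoints S g) →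
           ∀ S → ∣ S ∣ ≡ m → ∀ g → Sym S g → d ∣ dPoints S g
    step m rec S ∣S∣≡m g g∈Sym with dPoints S g in dPoints≡
    ... | zero  = d ∣0
    ... | suc k = subst (d ∣_) (trans (sym removeCycle-dPoints) dPoints≡) (∣m∣n⇒∣m+n rest-d∣ ∣-refl)
      where
      x-point : ∃ λ x → x ∈ S × InDCycle d g x
      x-point = HasCard-suc⇒∃ Finₛ (subst (HasCard Finₛ _) dPoints≡ (dPoints-HasCard S g))
      open Orbit g (proj₁ x-point) (proj₂ (proj₂ x-point))
      open Supported S g∈Sym (proj₁ (proj₂ x-point)) renaming (dPoints-removeCycle to removeCycle-dPoints)
      d≤m : d ≤ m
      d≤m = ℕP.≤-trans (ℕP.m≤n+m d _) (ℕP.≤-trans (ℕP.≤-reflexive (sym removeCycle-dPoints))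
              (subst (dPoints S g ≤_) ∣S∣≡m (dPoints-≤ S g)))
      rest-d∣ : d ∣ dPoints (S ∖ o) rest
      rest-d∣ = rec (ℕP.∸-monoʳ-< {m} {d} {0} (s≤s z≤n) d≤m) (S ∖ o)
                    (∣∖∣-∸ S o orbit-Arrangement ∣S∣≡m) rest rest-Sym

  module _ (S : Subset) (x : Fin N) (x∈S : x ∈ S) (c : ℕ) where
    open Cutting S x x∈S c

    Rooted-HasCard-Σ : (Q : Perm → Set) (R : Pair → Set) →
      (∀ p p' → Setoid._≈_ pairₛ p p' → R p → R p') →
      (∀ g → Rooted g → Q g → R (cut x g)) →
      (∀ g → Rooted g → R (cut x g) → Q g) →
      (Base : Vec (Fin N) d → Set) (Fibre : Vec (Fin N) d → Perm → Set) {K : ℕ}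
      (base : HasCard (Vecₛ d) Base K) (F : Fin K → ℕ) →
      (∀ i → HasCard permSetoid (Fibre (proj₁ base i)) (F i)) →
      (∀ p → Cut p × R p → Base (proj₁ p) × Fibre (proj₁ p) (proj₂ p)) →
      (∀ p → Base (proj₁ p) × Fibre (proj₁ p) (proj₂ p) → Cut p × R p) →
      HasCard permSetoid (λ g → Rooted g × Q g) (sum F)
    Rooted-HasCard-Σ Q R R-resp Q⇒R R⇒Q Base Fibre base F fibre to from =
      Rooted-HasCard Q R R-resp Q⇒R R⇒Q
        (HasCard-resp pairₛ (HasCard-Σ (Vecₛ d) permSetoid base F fibre (λ { s .s refl p → p })
                                                                    (λ { s .s h refl p → p }))
                      from to)

    Rooted-count : ∀ m' → ∣ S ∣ ≡ suc m' → d ≤ c → (v : ℚ) →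
      (∀ S' → ∣ S' ∣ ≡ suc m' ∸ d → ℕtoℚ (count S' (c ∸ d)) ≡ v) →
      Σ ℕ λ k → HasCard permSetoid Rooted k × ℕtoℚ k ≡ ℕtoℚ (fallingFactorial m' d') *ℚ v
    Rooted-count m' ∣S∣≡1+m' d≤c v count≡v =
      sum F ,
      HasCard-resp permSetoid rooted (λ _ → proj₁) (λ _ g-rooted → g-rooted , tt) ,
      ℕtoℚ-sum-const (fallingFactorial m' d') F v
        (λ i → count≡v (S ∖ arr i) (∣∖∣-∸ S (arr i) (proj₁ (arr-from i)) ∣S∣≡1+m'))
      where
      arrangements : HasCard (Vecₛ d) (λ s → Arrangement S s × lookup s zero ≡ x) (fallingFactorial m' d')
      arrangements = Arrangement-from-HasCard x∈S ∣S∣≡1+m'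
      arr : Fin (fallingFactorial m' d') → Vec (Fin N) d
      arr = proj₁ arrangements
      arr-from : ∀ i → Arrangement S (arr i) × lookup (arr i) zero ≡ x
      arr-from = proj₁ (proj₂ arrangements)
      F : Fin (fallingFactorial m' d') → ℕ
      F i = count (S ∖ arr i) (c ∸ d)
      Fibre : Vec (Fin N) d → Perm → Set
      Fibre s h = Sym (S ∖ s) h × dPoints (S ∖ s) h + d ≡ c
      fibre : ∀ i → HasCard permSetoid (Fibre (arr i)) (F i)
      fibre i = HasCard-resp permSetoid (count-HasCard (S ∖ arr i) (c ∸ d))
        (λ h (h∈Sym , eq) → h∈Sym , trans (cong (_+ d) eq) (ℕP.m∸n+n≡m d≤c))
        (λ h (h∈Sym , eq) → h∈Sym , trans (sym (ℕP.m+n∸n≡m _ d)) (cong (_∸ d) eq))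
      rooted : HasCard permSetoid (λ g → Rooted g × ⊤) (sum F)
      rooted = Rooted-HasCard-Σ (λ _ → ⊤) (λ _ → ⊤) (λ _ _ _ _ → tt) (λ _ _ _ → tt) (λ _ _ _ → tt)
        (λ s → Arrangement S s × lookup s zero ≡ x) Fibre arrangements F fibre
        (λ { _ ((s-arr , s₀≡x , h∈Sym , eq) , _) → (s-arr , s₀≡x) , h∈Sym , eq })
        (λ { _ ((s-arr , s₀≡x) , h∈Sym , eq) → (s-arr , s₀≡x , h∈Sym , eq) , tt })

  CountFormula : ℕ → Set
  CountFormula m = ∀ S → ∣ S ∣ ≡ m → ∀ j → j ≤ m / d →
    ℕtoℚ (count S (j * d)) ≡ ℕtoℚ (m !) *ℚ bSeq d (m / d) j

  [m∸d]/d≡m/d∸1 : ∀ m → (m ∸ d) / d ≡ m / d ∸ 1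
  [m∸d]/d≡m/d∸1 m = trans (ℕ÷.[m∸n]/n≡m/n∸1 m d) (pred≡∸1 (m / d))
    where
    pred≡∸1 : ∀ k → ℕ.pred k ≡ k ∸ 1
    pred≡∸1 zero    = refl
    pred≡∸1 (suc k) = refl

  count*c≡ : ∀ m' → (∀ {m} → m < suc m' → CountFormula m) →
    ∀ S → ∣ S ∣ ≡ suc m' → ∀ j' → suc j' ≤ suc m' / d →
    ℕtoℚ (count S (suc j' * d) * (suc j' * d)) ≡ ℕtoℚ (suc m' !) *ℚ bSeq d ((suc m' ∸ d) / d) j'
  count*c≡ m' formula S ∣S∣≡m j' j<i = begin
    ℕtoℚ (count S c * c)                           ≡⟨ cong ℕtoℚ (count*c≡∑ S c F rooted) ⟩
    ℕtoℚ (sum F)                                   ≡⟨ ℕtoℚ-sum-const ∣ S ∣ F _ (λ x → proj₂ (proj₂ (rooted-count x))) ⟩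
    ℕtoℚ ∣ S ∣ *ℚ (ℕtoℚ ff *ℚ (ℕtoℚ ((m ∸ d) !) *ℚ b))
      ≡⟨ cong (λ k → ℕtoℚ k *ℚ (ℕtoℚ ff *ℚ (ℕtoℚ ((m ∸ d) !) *ℚ b))) ∣S∣≡m ⟩
    ℕtoℚ m *ℚ (ℕtoℚ ff *ℚ (ℕtoℚ ((m ∸ d) !) *ℚ b))
      ≡⟨ ℚ-Solver.solve 4 (λ a f e b → a :* (f :* (e :* b)) := ((a :* f) :* e) :* b) refl
           (ℕtoℚ m) (ℕtoℚ ff) (ℕtoℚ ((m ∸ d) !)) b ⟩
    ((ℕtoℚ m *ℚ ℕtoℚ ff) *ℚ ℕtoℚ ((m ∸ d) !)) *ℚ b
      ≡⟨ cong (_*ℚ b) (trans (ℕtoℚ-* (m * ff) ((m ∸ d) !)) (cong (_*ℚ ℕtoℚ ((m ∸ d) !)) (ℕtoℚ-* m ff))) ⟨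
    ℕtoℚ (m * ff * (m ∸ d) !) *ℚ b                 ≡⟨ cong (λ k → ℕtoℚ k *ℚ b) (fallingFactorial-! m d d≤m) ⟩
    ℕtoℚ (m !) *ℚ b                                ∎
    where
    open ≡-Reasoning
    open ℚ-Solver using (_:*_; _:=_)
    m c ff : ℕ
    m = suc m'
    c = suc j' * d
    ff = fallingFactorial m' d'
    b : ℚ
    b = bSeq d ((m ∸ d) / d) j'
    d≤c : d ≤ c
    d≤c = ℕP.m≤m+n d _
    d≤m : d ≤ m
    d≤m = ℕP.≤-trans d≤c (ℕP.≤-trans (ℕP.*-monoˡ-≤ d j<i) (ℕ÷.m/n*n≤m m d))
    count-rest : ∀ S' → ∣ S' ∣ ≡ m ∸ d → ℕtoℚ (count S' (c ∸ d)) ≡ ℕtoℚ ((m ∸ d) !) *ℚ b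
    count-rest S' ∣S'∣≡ = trans (cong (λ k → ℕtoℚ (count S' k)) (ℕP.m+n∸m≡n d (j' * d)))
      (formula (ℕP.∸-monoʳ-< {m} {d} {0} (s≤s z≤n) d≤m) S' ∣S'∣≡ j'
        (subst (j' ≤_) (sym ([m∸d]/d≡m/d∸1 m)) (ℕP.∸-monoˡ-≤ 1 j<i)))
    S-elem : Fin ∣ S ∣ → Fin N
    S-elem = proj₁ (∣∣-HasCard S)
    open Cutting S using (Rooted)
    rooted-count : ∀ x → Σ ℕ λ k → HasCard permSetoid (Rooted (S-elem x) (proj₁ (proj₂ (∣∣-HasCard S)) x) c) k ×
                                  ℕtoℚ k ≡ ℕtoℚ ff *ℚ (ℕtoℚ ((m ∸ d) !) *ℚ b)
    rooted-count x = Rooted-count S (S-elem x) (proj₁ (proj₂ (∣∣-HasCard S)) x) c m' ∣S∣≡m d≤c _ count-rest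
    F : Fin ∣ S ∣ → ℕ
    F x = proj₁ (rooted-count x)
    rooted : ∀ x → HasCard permSetoid (λ g → WithDPoints S c g × InDCycle d g (S-elem x)) (F x)
    rooted x = HasCard-resp permSetoid (proj₁ (proj₂ (rooted-count x)))
      (λ g (g∈Sym , eq , x∈C) → (g∈Sym , eq) , x∈C) (λ g ((g∈Sym , eq) , x∈C) → g∈Sym , eq , x∈C)

  count-formula-pos : ∀ m' → (∀ {m} → m < suc m' → CountFormula m) →
    ∀ S → ∣ S ∣ ≡ suc m' → ∀ j' → suc j' ≤ suc m' / d →
    ℕtoℚ (count S (suc j' * d)) ≡ ℕtoℚ (suc m' !) *ℚ bSeq d (suc m' / d) (suc j')
  count-formula-pos m' formula S ∣S∣≡m j' j<i =
    *-cancelʳ-ℕtoℚ c (ℕtoℚ (count S c)) _ (begin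
      ℕtoℚ (count S c) *ℚ ℕtoℚ c                  ≡⟨ ℕtoℚ-* (count S c) c ⟨
      ℕtoℚ (count S c * c)                         ≡⟨ count*c≡ m' formula S ∣S∣≡m j' j<i ⟩
      ℕtoℚ (m !) *ℚ ((1ℚ - aSeq d ((m ∸ d) / d ∸ j')) *ℚ coeff d j')
        ≡⟨ cong₂ (λ k e → ℕtoℚ (m !) *ℚ ((1ℚ - aSeq d k) *ℚ e))
             (trans (cong (_∸ j') ([m∸d]/d≡m/d∸1 m)) (ℕP.∸-+-assoc (m / d) 1 j')) (Coefficients.coeff-step d' j') ⟩
      ℕtoℚ (m !) *ℚ ((1ℚ - A) *ℚ (ℕtoℚ c *ℚ coeff d (suc j')))
        ≡⟨ ℚ-Solver.solve 4 (λ M A c k → M :* ((con 1ℚ :- A) :* (c :* k)) := (M :* ((con 1ℚ :- A) :* k)) :* c)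
             refl (ℕtoℚ (m !)) A (ℕtoℚ c) (coeff d (suc j')) ⟩
      ℕtoℚ (m !) *ℚ bSeq d (m / d) (suc j') *ℚ ℕtoℚ c ∎)
    where
    open ≡-Reasoning
    open ℚ-Solver using (_:*_; _:-_; _:=_; con)
    m c : ℕ
    m = suc m'
    c = suc j' * d
    A : ℚ
    A = aSeq d (m / d ∸ suc j')

  ∑count≡! : ∀ m S → ∣ S ∣ ≡ m → sum (λ (t : Fin (suc (m / d))) → count S (toℕ t * d)) ≡ m !
  ∑count≡! m S ∣S∣≡m = HasCard-≡ permSetoid by-dPoints (Sym-HasCard m S ∣S∣≡m) (λ g (_ , g∈Sym , _) → g∈Sym) cover
    where
    by-dPoints : HasCard permSetoid (λ g → ∃ λ t → WithDPoints S (toℕ t * d) g)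
                         (sum (λ (t : Fin (suc (m / d))) → count S (toℕ t * d)))
    by-dPoints = HasCard-∑ permSetoid (suc (m / d)) (λ t → count S (toℕ t * d))
      (λ t → WithDPoints S (toℕ t * d)) (λ t → count-HasCard S (toℕ t * d))
      (λ t t' g g' (_ , eq) (_ , eq') g≗g' → FinP.toℕ-injective (ℕP.*-cancelʳ-≡ (toℕ t) (toℕ t') d
         (trans (sym eq) (trans (dPoints-resp S {g} {g'} g≗g') eq'))))
    cover : ∀ g → Sym S g → ∃ λ t → WithDPoints S (toℕ t * d) g
    cover g g∈Sym = fromℕ< (s≤s t≤i) , g∈Sym , trans t-eq (cong (_* d) (sym (FinP.toℕ-fromℕ< (s≤s t≤i))))
      where
      t : ℕ
      t = quotient (d∣dPoints m S ∣S∣≡m g g∈Sym)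
      t-eq : dPoints S g ≡ t * d
      t-eq = _∣_.equality (d∣dPoints m S ∣S∣≡m g g∈Sym)
      t≤i : t ≤ m / d
      t≤i = subst (_≤ m / d) (ℕ÷.m*n/n≡m t d)
              (ℕ÷./-monoˡ-≤ d (subst (_≤ m) t-eq (subst (dPoints S g ≤_) ∣S∣≡m (dPoints-≤ S g))))

  count-formula-zero : ∀ m → (∀ S → ∣ S ∣ ≡ m → ∀ j' → suc j' ≤ m / d →
      ℕtoℚ (count S (suc j' * d)) ≡ ℕtoℚ (m !) *ℚ bSeq d (m / d) (suc j')) →
    ∀ S → ∣ S ∣ ≡ m → ℕtoℚ (count S 0) ≡ ℕtoℚ (m !) *ℚ bSeq d (m / d) 0
  count-formula-zero m formula-pos S ∣S∣≡m = begin
    C₀                               ≡⟨ ℚ-Solver.solve 3 (λ Y Z A → Y := (Y :+ Z :* A) :- Z :* A) refl C₀ M a ⟩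
    (C₀ +ℚ M *ℚ a) - M *ℚ a         ≡⟨ cong (_- M *ℚ a) m!≡ ⟨
    M - M *ℚ a                      ≡⟨ ℚ-Solver.solve 2 (λ Z A → Z :- Z :* A := Z :* ((con 1ℚ :- A) :* con 1ℚ)) refl M a ⟩
    M *ℚ bSeq d (m / d) 0            ∎
    where
    open ≡-Reasoning
    open ℚ-Solver using (_:*_; _:+_; _:-_; _:=_; con)
    C₀ M a : ℚ
    C₀ = ℕtoℚ (count S 0)
    M = ℕtoℚ (m !)
    a = aSeq d (m / d)
    Cₚ : Fin (m / d) → ℕ
    Cₚ t = count S (suc (toℕ t) * d)
    m!≡ : M ≡ C₀ +ℚ M *ℚ a
    m!≡ = begin
      M                                          ≡⟨ cong ℕtoℚ (∑count≡! m S ∣S∣≡m) ⟨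
      ℕtoℚ (count S 0 + sum Cₚ)                  ≡⟨ ℕtoℚ-+ (count S 0) (sum Cₚ) ⟩
      C₀ +ℚ ℕtoℚ (sum Cₚ)                        ≡⟨ cong (C₀ +ℚ_) (ℕtoℚ-sum (m / d) Cₚ) ⟩
      C₀ +ℚ ℚ∑.sum (ℕtoℚ ∘ Cₚ)                  ≡⟨ cong (C₀ +ℚ_) (ℚ∑.sum-cong-≗ λ t → formula-pos S ∣S∣≡m (toℕ t) (FinP.toℕ<n t)) ⟩
      C₀ +ℚ ℚ∑.sum (λ (t : Fin (m / d)) → M *ℚ bSeq d (m / d) (suc (toℕ t)))
        ≡⟨ cong (C₀ +ℚ_) (ℚ∑.*-distribˡ-sum {m / d} M (λ t → bSeq d (m / d) (suc (toℕ t)))) ⟨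
      C₀ +ℚ M *ℚ ℚ∑.sum (λ (t : Fin (m / d)) → bSeq d (m / d) (suc (toℕ t)))
        ≡⟨ cong (λ s → C₀ +ℚ M *ℚ s) (Coefficients.a≡∑b d' (m / d)) ⟨
      C₀ +ℚ M *ℚ a                               ∎

  count-formula : ∀ m → CountFormula m
  count-formula = <-rec CountFormula step
    where
    step : ∀ m → (∀ {m'} → m' < m → CountFormula m') → CountFormula m
    step zero     _       S ∣S∣≡0   zero     _   = count-formula-zero zero (λ _ _ _ ()) S ∣S∣≡0
    step (suc m') formula S ∣S∣≡m zero     _   = count-formula-zero (suc m') (count-formula-pos m' formula) S ∣S∣≡m
    step (suc m') formula S ∣S∣≡m (suc j') j≤i = count-formula-pos m' formula S ∣S∣≡m j' j≤i

-- The four counts, for n = 2 + d' + r with d' ≤ r, that is n ≥ 2d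

module Parts (d' r : ℕ) (d'≤r : d' ≤ r) where

  p : ℕ
  p = d' + r

  n : ℕ
  n = suc (suc p)

  open Cycles n d'

  all : Subset
  all _ = true

  ∣all∣ : ∣ all ∣ ≡ n
  ∣all∣ = HasCard-unique Finₛ (∣∣-HasCard all) ((λ i → i) , (λ _ → refl) , (λ _ _ eq → eq) , (λ x _ → x , refl))

  Sym-all : ∀ g → Sym all g
  Sym-all g y y∉ = ⊥-elim (y∉ refl)

  ExactlyDCycles⇒ : ∀ j g → ExactlyDCycles d j g → dPoints all g ≡ j * d
  ExactlyDCycles⇒ j g (f , f-in , f-inj , cover) = HasCard-≡ Finₛ (dPoints-HasCard all g)
    (f , f-in , f-inj , λ x x∈C → let (i , eq) = cover x x∈C in i , sym eq) (λ _ → proj₂) (λ _ x∈C → refl , x∈C)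

  ⇒ExactlyDCycles : ∀ j g → dPoints all g ≡ j * d → ExactlyDCycles d j g
  ⇒ExactlyDCycles j g eq with subst (HasCard Finₛ _) eq (dPoints-HasCard all g)
  ... | f , f-in , f-inj , cover = f , proj₂ ∘ f-in , f-inj , λ x x∈C → let (i , eq') = cover x (refl , x∈C) in i , sym eq'

  i : ℕ
  i = n / d

  part-b : ∀ j → 1 ≤ j → j ≤ i → ∃ λ k → HasCardPerm {n} (ExactlyDCycles d j) k ×
    ℕtoℚ (n !) *ℚ bSeq d i j ≡ ℕtoℚ k
  part-b j _ j≤i = count all (j * d) ,
    HasCard-resp permSetoid (count-HasCard all (j * d)) (λ g → ⇒ExactlyDCycles j g ∘ proj₂)
      (λ g g∈B → Sym-all g , ExactlyDCycles⇒ j g g∈B) ,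
    sym (count-formula n all ∣all∣ j j≤i)

  part-a : ∃ λ k → HasCardPerm {n} (HasDCycle d) k × ℕtoℚ (n !) *ℚ aSeq d i ≡ ℕtoℚ k
  part-a with count-complement all 0
  ... | k , with-dPoints , sum≡ = k ,
    HasCard-resp permSetoid with-dPoints (λ g → has-dCycle g ∘ proj₂) (λ g g∈A → Sym-all g , no-dPoints g g∈A) ,
    (begin
      M *ℚ aSeq d i                               ≡⟨ ℚ-Solver.solve 2 (λ M A → M :* A := M :- M :* ((con 1ℚ :- A) :* con 1ℚ)) refl M (aSeq d i) ⟩
      M - M *ℚ bSeq d i 0                        ≡⟨ cong (M -_) (count-formula n all ∣all∣ 0 z≤n) ⟨
      M - ℕtoℚ (count all 0)                     ≡⟨ cong (_- ℕtoℚ (count all 0)) M≡ ⟩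
      (ℕtoℚ (count all 0) +ℚ ℕtoℚ k) - ℕtoℚ (count all 0)
        ≡⟨ ℚ-Solver.solve 2 (λ C K → (C :+ K) :- C := K) refl (ℕtoℚ (count all 0)) (ℕtoℚ k) ⟩
      ℕtoℚ k                                      ∎)
    where
    open ≡-Reasoning
    open ℚ-Solver using (_:*_; _:+_; _:-_; _:=_; con)
    M : ℚ
    M = ℕtoℚ (n !)
    M≡ : M ≡ ℕtoℚ (count all 0) +ℚ ℕtoℚ k
    M≡ = trans (cong (ℕtoℚ ∘ _!) (sym ∣all∣)) (trans (cong ℕtoℚ (sym sum≡)) (ℕtoℚ-+ (count all 0) k))
    has-dCycle : ∀ g → dPoints all g ≢ 0 → HasDCycle d g
    has-dCycle g ≢0 with dPoints all g in eq
    ... | zero  = ⊥-elim (≢0 refl)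
    ... | suc _ = let (x , _ , x∈C) = HasCard-suc⇒∃ Finₛ (subst (HasCard Finₛ _) eq (dPoints-HasCard all g)) in x , x∈C
    no-dPoints : ∀ g → HasDCycle d g → dPoints all g ≢ 0
    no-dPoints g (x , x∈C) ≡0 = HasCard-0⇒∅ Finₛ (subst (HasCard Finₛ _) ≡0 (dPoints-HasCard all g)) x (refl , x∈C)

  x₀ x₁ : Fin n
  x₀ = zero
  x₁ = suc zero

  x₁∈all─x₀ : x₁ ∈ all ─ x₀
  x₁∈all─x₀ = ∈-minus⁺ all (FinP._≟ x₀) {x₁} refl λ ()

  x₀∈all─x₁ : x₀ ∈ all ─ x₁
  x₀∈all─x₁ = ∈-minus⁺ all (FinP._≟ x₁) {x₀} refl λ ()

  ∣all─∣ : ∀ x → ∣ all ─ x ∣ ≡ suc p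
  ∣all─∣ x = ∣─∣-∸ {all} {x} refl ∣all∣

  n∸d≡1+r : n ∸ d ≡ suc r
  n∸d≡1+r = trans (cong (_∸ d') (sym (ℕP.+-suc d' r))) (ℕP.m+n∸m≡n d' (suc r))

  n!≡ : n ! ≡ n * suc p * p !
  n!≡ = sym (ℕP.*-assoc n (suc p) (p !))

  p∸d'≡r : p ∸ d' ≡ r
  p∸d'≡r = ℕP.m+n∸m≡n d' r

  falling-p : fallingFactorial p d' * r ! ≡ p !
  falling-p = trans (cong (λ m → fallingFactorial p d' * m !) (sym p∸d'≡r)) (fallingFactorial-! p d' (ℕP.m≤m+n d' r))

  falling-suc-p : fallingFactorial (suc p) d' * (suc r) ! ≡ suc p !
  falling-suc-p = trans (cong (λ m → fallingFactorial (suc p) d' * m !) (sym n∸d≡1+r))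
                        (fallingFactorial-! (suc p) d' (ℕP.m≤n⇒m≤1+n (ℕP.m≤m+n d' r)))

  2n∸d∸1≡ : 2 * n ∸ d ∸ 1 ≡ suc p + suc r
  2n∸d∸1≡ = trans (ℕP.∸-+-assoc (2 * n) d 1)
    (trans (cong (_∸ (d + 1)) 2n≡) (ℕP.m+n∸n≡m (suc p + suc r) (d + 1)))
    where
    2n≡ : 2 * n ≡ (suc p + suc r) + (d + 1)
    2n≡ = ℕ-Solver.solve 2 (λ a b → con 2 :* (con 2 :+ (a :+ b)) := ((con 1 :+ (a :+ b)) :+ (con 1 :+ b)) :+ ((con 1 :+ a) :+ con 1))
            refl d' r
      where open ℕ-Solver using (_:+_; _:*_; _:=_; con)

  falling-sum : (fallingFactorial (suc p) d' + fallingFactorial p d') * (n ∸ d) ! ≡ p ! * (2 * n ∸ d ∸ 1)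
  falling-sum = begin
    (fallingFactorial (suc p) d' + fallingFactorial p d') * (n ∸ d) !
      ≡⟨ cong (λ m → (fallingFactorial (suc p) d' + fallingFactorial p d') * m !) n∸d≡1+r ⟩
    (fallingFactorial (suc p) d' + fallingFactorial p d') * (suc r) !
      ≡⟨ ℕ-Solver.solve 4 (λ a b r r! → (a :+ b) :* ((con 1 :+ r) :* r!) := a :* ((con 1 :+ r) :* r!) :+ (con 1 :+ r) :* (b :* r!))
           refl (fallingFactorial (suc p) d') (fallingFactorial p d') r (r !) ⟩
    fallingFactorial (suc p) d' * (suc r) ! + suc r * (fallingFactorial p d' * r !)
      ≡⟨ cong₂ (λ a b → a + suc r * b) falling-suc-p falling-p ⟩
    suc p * p ! + suc r * p !
      ≡⟨ ℕP.*-distribʳ-+ (p !) (suc p) (suc r) ⟨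
    (suc p + suc r) * p !
      ≡⟨ cong (_* p !) 2n∸d∸1≡ ⟨
    (2 * n ∸ d ∸ 1) * p !
      ≡⟨ ℕP.*-comm _ (p !) ⟩
    p ! * (2 * n ∸ d ∸ 1) ∎
    where
    open ≡-Reasoning
    open ℕ-Solver using (_:+_; _:*_; _:=_; con)

  d≤1*d : d ≤ 1 * d
  d≤1*d = ℕP.≤-reflexive (sym (ℕP.*-identityˡ d))

  count-no-dCycles : ∀ m S' → ∣ S' ∣ ≡ m → ℕtoℚ (count S' (1 * d ∸ d)) ≡ ℕtoℚ (m !) *ℚ bSeq d (m / d) 0
  count-no-dCycles m S' ∣S'∣≡m =
    trans (cong (λ c → ℕtoℚ (count S' c)) (ℕP.m+n∸m≡n d 0)) (count-formula m S' ∣S'∣≡m 0 z≤n)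

  b₀≡ : ∀ m k → m / d ≡ i ∸ k → bSeq d (m / d) 0 ≡ 1ℚ - aSeq d (i ∸ k)
  b₀≡ m k eq = trans (QP.*-identityʳ _) (cong (λ l → 1ℚ - aSeq d l) eq)

  part-c : ∃ λ k → HasCardPerm {n} (SetC d) k ×
    ℕtoℚ (n !) *ℚ (+ (2 * n ∸ d ∸ 1) ℚ./ (n * (n ∸ 1))) *ℚ (1ℚ - aSeq d (i ∸ 1)) ≡ ℕtoℚ k
  part-c = k₀ + sum F₁ ,
    HasCard-resp permSetoid
      (HasCard-⊎ permSetoid (proj₁ (proj₂ count₀)) count₁
        (λ g g' (_ , _ , x₀∈C) (_ , x₀∉C) g≗g' → x₀∉C (InDCycle-resp d {g} {g'} g≗g' x₀ x₀∈C)))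
      to-C from-C ,
    (begin
      ℕtoℚ (n !) *ℚ (+ (2 * n ∸ d ∸ 1) ℚ./ (n * suc p)) *ℚ X
        ≡⟨ cong (λ k → ℕtoℚ k *ℚ (+ (2 * n ∸ d ∸ 1) ℚ./ (n * suc p)) *ℚ X) n!≡ ⟩
      ℕtoℚ (n * suc p * p !) *ℚ (+ (2 * n ∸ d ∸ 1) ℚ./ (n * suc p)) *ℚ X
        ≡⟨ cong (_*ℚ X) (ℕtoℚ-*-/ (n * suc p) (p !) (2 * n ∸ d ∸ 1)) ⟩
      ℕtoℚ (p ! * (2 * n ∸ d ∸ 1)) *ℚ X
        ≡⟨ cong (λ k → ℕtoℚ k *ℚ X) falling-sum ⟨
      ℕtoℚ ((fallingFactorial (suc p) d' + fallingFactorial p d') * (n ∸ d) !) *ℚ X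
        ≡⟨ cong (_*ℚ X) (trans (ℕtoℚ-* (fallingFactorial (suc p) d' + fallingFactorial p d') ((n ∸ d) !)) (cong (_*ℚ ℕtoℚ ((n ∸ d) !)) (ℕtoℚ-+ (fallingFactorial (suc p) d') (fallingFactorial p d')))) ⟩
      (ℕtoℚ (fallingFactorial (suc p) d') +ℚ ℕtoℚ (fallingFactorial p d')) *ℚ ℕtoℚ ((n ∸ d) !) *ℚ X
        ≡⟨ ℚ-Solver.solve 4 (λ a b f x → ((a :+ b) :* f) :* x := a :* (f :* x) :+ b :* (f :* x)) refl
             (ℕtoℚ (fallingFactorial (suc p) d')) (ℕtoℚ (fallingFactorial p d')) (ℕtoℚ ((n ∸ d) !)) X ⟩
      ℕtoℚ (fallingFactorial (suc p) d') *ℚ v +ℚ ℕtoℚ (fallingFactorial p d') *ℚ v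
        ≡⟨ cong₂ _+ℚ_ (sym (proj₂ (proj₂ count₀))) (sym count₁-value) ⟩
      ℕtoℚ k₀ +ℚ ℕtoℚ (sum F₁)                   ≡⟨ ℕtoℚ-+ k₀ (sum F₁) ⟨
      ℕtoℚ (k₀ + sum F₁)                         ∎)
    where
    open ≡-Reasoning
    open ℚ-Solver using (_:*_; _:+_; _:=_)
    X v : ℚ
    X = 1ℚ - aSeq d (i ∸ 1)
    v = ℕtoℚ ((n ∸ d) !) *ℚ X
    count-rest : ∀ S' → ∣ S' ∣ ≡ n ∸ d → ℕtoℚ (count S' (1 * d ∸ d)) ≡ v
    count-rest S' ∣S'∣≡ = trans (count-no-dCycles (n ∸ d) S' ∣S'∣≡)
      (cong (ℕtoℚ ((n ∸ d) !) *ℚ_) (b₀≡ (n ∸ d) 1 ([m∸d]/d≡m/d∸1 n)))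
    open Cutting all using (Rooted)
    count₀ : Σ ℕ λ k → HasCard permSetoid (Rooted x₀ refl (1 * d)) k × ℕtoℚ k ≡ ℕtoℚ (fallingFactorial (suc p) d') *ℚ v
    count₀ = Rooted-count all x₀ refl (1 * d) (suc p) ∣all∣ d≤1*d v count-rest
    k₀ : ℕ
    k₀ = proj₁ count₀
    arrangements : HasCard (Vecₛ d) (λ s → Arrangement (all ─ x₀) s × lookup s zero ≡ x₁) (fallingFactorial p d')
    arrangements = Arrangement-from-HasCard {all ─ x₀} {x₁} {p} x₁∈all─x₀ (∣all─∣ x₀)
    arr : Fin (fallingFactorial p d') → Vec (Fin n) d
    arr = proj₁ arrangements
    arr-all : ∀ t → Arrangement all (arr t)
    arr-all t = proj₁ (Arrangement-─⁻ all x₀ (arr t) (proj₁ (proj₁ (proj₂ arrangements) t)))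
    F₁ : Fin (fallingFactorial p d') → ℕ
    F₁ t = count (all ∖ arr t) (1 * d ∸ d)
    count₁ : HasCard permSetoid (λ g → Rooted x₁ refl (1 * d) g × ¬ InDCycle d g x₀) (sum F₁)
    count₁ = Rooted-HasCard-Σ all x₁ refl (1 * d) (λ g → ¬ InDCycle d g x₀) (λ (s , _) → ¬ x₀ ∈ᵥ s)
      (λ { (s , h) (.s , h') (refl , _) x₀∉s → x₀∉s })
      (λ g (_ , _ , x₁∈C) x₀∉C (k , eq) → x₀∉C (subst (InDCycle d g) eq (Orbit.orbit-InDCycle g x₁ x₁∈C k)))
      (λ g (g∈Sym , dPoints≡d , x₁∈C) →
         Orbit.Supported.single-cycle g x₁ x₁∈C all g∈Sym refl (trans dPoints≡d (ℕP.*-identityˡ d)) x₀ refl)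
      (λ s → Arrangement (all ─ x₀) s × lookup s zero ≡ x₁)
      (λ s h → Sym (all ∖ s) h × dPoints (all ∖ s) h + d ≡ 1 * d) arrangements F₁
      (λ t → HasCard-resp permSetoid (count-HasCard (all ∖ arr t) (1 * d ∸ d))
         (λ h (h∈Sym , eq) → h∈Sym , trans (cong (_+ d) eq) (ℕP.m∸n+n≡m d≤1*d))
         (λ h (h∈Sym , eq) → h∈Sym , trans (sym (ℕP.m+n∸n≡m _ d)) (cong (_∸ d) eq)))
      (λ { (s , h) ((s-arr , s₀≡x₁ , h∈Sym , eq) , x₀∉s) → (Arrangement-─⁺ all x₀ s s-arr x₀∉s , s₀≡x₁) , h∈Sym , eq })
      (λ { (s , h) ((s-arr , s₀≡x₁) , h∈Sym , eq) → let (s-arr' , x₀∉s) = Arrangement-─⁻ all x₀ s s-arr in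
                                                    (s-arr' , s₀≡x₁ , h∈Sym , eq) , x₀∉s })
    count₁-value : ℕtoℚ (sum F₁) ≡ ℕtoℚ (fallingFactorial p d') *ℚ v
    count₁-value = ℕtoℚ-sum-const _ F₁ v (λ t → count-rest (all ∖ arr t) (trans (∣∖∣-∸ all (arr t) (arr-all t) ∣all∣) refl))
    to-C : ∀ g → Rooted x₀ refl (1 * d) g ⊎ (Rooted x₁ refl (1 * d) g × ¬ InDCycle d g x₀) → SetC d g
    to-C g (inj₁ (_ , dPoints≡d , x₀∈C))       = ⇒ExactlyDCycles 1 g dPoints≡d , x₀ , inj₁ refl , x₀∈C
    to-C g (inj₂ ((_ , dPoints≡d , x₁∈C) , _)) = ⇒ExactlyDCycles 1 g dPoints≡d , x₁ , inj₂ refl , x₁∈C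
    from-C : ∀ g → SetC d g → Rooted x₀ refl (1 * d) g ⊎ (Rooted x₁ refl (1 * d) g × ¬ InDCycle d g x₀)
    from-C g (g∈B , x , inj₁ x≡0 , x∈C) =
      inj₁ (Sym-all g , ExactlyDCycles⇒ 1 g g∈B , subst (InDCycle d g) (FinP.toℕ-injective {i = x} {j = x₀} x≡0) x∈C)
    from-C g (g∈B , x , inj₂ x≡1 , x∈C) with InDCycle? d g x₀
    ... | yes x₀∈C = inj₁ (Sym-all g , ExactlyDCycles⇒ 1 g g∈B , x₀∈C)
    ... | no x₀∉C  = inj₂ ((Sym-all g , ExactlyDCycles⇒ 1 g g∈B ,
                           subst (InDCycle d g) (FinP.toℕ-injective {i = x} {j = x₁} x≡1) x∈C) , x₀∉C)

  falling-p-r : fallingFactorial p d' * (fallingFactorial r d' * (r ∸ d') !) ≡ p !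
  falling-p-r = trans (cong (fallingFactorial p d' *_) (fallingFactorial-! r d' d'≤r)) falling-p

  part-d : ∃ λ k → HasCardPerm {n} (SetD d) k ×
    ℕtoℚ (n !) *ℚ (+ 1 ℚ./ (n * (n ∸ 1))) *ℚ (1ℚ - aSeq d (i ∸ 2)) ≡ ℕtoℚ k
  part-d = sum F , HasCard-resp permSetoid count-D to-D from-D ,
    (begin
      ℕtoℚ (n !) *ℚ (+ 1 ℚ./ (n * suc p)) *ℚ X
        ≡⟨ cong (λ k → ℕtoℚ k *ℚ (+ 1 ℚ./ (n * suc p)) *ℚ X) n!≡ ⟩
      ℕtoℚ (n * suc p * p !) *ℚ (+ 1 ℚ./ (n * suc p)) *ℚ X
        ≡⟨ cong (_*ℚ X) (trans (ℕtoℚ-*-/ (n * suc p) (p !) 1) (cong ℕtoℚ (ℕP.*-identityʳ (p !)))) ⟩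
      ℕtoℚ (p !) *ℚ X
        ≡⟨ cong (λ k → ℕtoℚ k *ℚ X) falling-p-r ⟨
      ℕtoℚ (fallingFactorial p d' * (fallingFactorial r d' * (r ∸ d') !)) *ℚ X
        ≡⟨ cong (_*ℚ X) (trans (ℕtoℚ-* (fallingFactorial p d') _) (cong (ℕtoℚ (fallingFactorial p d') *ℚ_)
             (ℕtoℚ-* (fallingFactorial r d') ((r ∸ d') !)))) ⟩
      (ℕtoℚ (fallingFactorial p d') *ℚ (ℕtoℚ (fallingFactorial r d') *ℚ ℕtoℚ ((r ∸ d') !))) *ℚ X
        ≡⟨ ℚ-Solver.solve 4 (λ a b f x → (a :* (b :* f)) :* x := a :* (b :* (f :* x))) refl
             (ℕtoℚ (fallingFactorial p d')) (ℕtoℚ (fallingFactorial r d')) (ℕtoℚ ((r ∸ d') !)) X ⟩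
      ℕtoℚ (fallingFactorial p d') *ℚ (ℕtoℚ (fallingFactorial r d') *ℚ v)
        ≡⟨ ℕtoℚ-sum-const _ F _ (λ t → proj₂ (proj₂ (inner t))) ⟨
      ℕtoℚ (sum F) ∎)
    where
    open ≡-Reasoning
    open ℚ-Solver using (_:*_; _:=_)
    X v : ℚ
    X = 1ℚ - aSeq d (i ∸ 2)
    v = ℕtoℚ ((r ∸ d') !) *ℚ X
    [1+r∸d]/d≡i∸2 : (suc r ∸ d) / d ≡ i ∸ 2
    [1+r∸d]/d≡i∸2 = begin
      (suc r ∸ d) / d       ≡⟨ cong (λ m → (m ∸ d) / d) n∸d≡1+r ⟨
      (n ∸ d ∸ d) / d       ≡⟨ [m∸d]/d≡m/d∸1 (n ∸ d) ⟩
      (n ∸ d) / d ∸ 1       ≡⟨ cong (_∸ 1) ([m∸d]/d≡m/d∸1 n) ⟩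
      i ∸ 1 ∸ 1             ≡⟨ ℕP.∸-+-assoc i 1 1 ⟩
      i ∸ 2                 ∎
    count-rest : ∀ S' → ∣ S' ∣ ≡ suc r ∸ d → ℕtoℚ (count S' (1 * d ∸ d)) ≡ v
    count-rest S' ∣S'∣≡ = trans (count-no-dCycles (suc r ∸ d) S' ∣S'∣≡)
      (cong (ℕtoℚ ((r ∸ d') !) *ℚ_) (b₀≡ (suc r ∸ d) 2 [1+r∸d]/d≡i∸2))
    arrangements : HasCard (Vecₛ d) (λ s → Arrangement (all ─ x₁) s × lookup s zero ≡ x₀) (fallingFactorial p d')
    arrangements = Arrangement-from-HasCard {all ─ x₁} {x₀} {p} x₀∈all─x₁ (∣all─∣ x₁)
    arr : Fin (fallingFactorial p d') → Vec (Fin n) d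
    arr = proj₁ arrangements
    arr-split : ∀ t → Arrangement all (arr t) × ¬ x₁ ∈ᵥ arr t
    arr-split t = Arrangement-─⁻ all x₁ (arr t) (proj₁ (proj₁ (proj₂ arrangements) t))
    x₁∈all∖arr : ∀ t → x₁ ∈ all ∖ arr t
    x₁∈all∖arr t = ∈-minus⁺ all (_∈ᵥ? arr t) refl (proj₂ (arr-split t))
    inner : ∀ t → Σ ℕ λ k → HasCard permSetoid (Cutting.Rooted (all ∖ arr t) x₁ (x₁∈all∖arr t) (1 * d)) k ×
                           ℕtoℚ k ≡ ℕtoℚ (fallingFactorial r d') *ℚ v
    inner t = Rooted-count (all ∖ arr t) x₁ (x₁∈all∖arr t) (1 * d) r
                (trans (∣∖∣-∸ all (arr t) (proj₁ (arr-split t)) ∣all∣) n∸d≡1+r) d≤1*d v count-rest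
    F : Fin (fallingFactorial p d') → ℕ
    F t = proj₁ (inner t)
    open Cutting all x₀ refl (2 * d) using (Rooted)
    Separated : Perm → Set
    Separated g = InDCycle d g x₁ × (∀ m → iter (g ⟨$⟩ʳ_) m x₀ ≢ x₁)
    count-D : HasCard permSetoid (λ g → Rooted g × Separated g) (sum F)
    count-D = Rooted-HasCard-Σ all x₀ refl (2 * d) Separated (λ (s , h) → ¬ x₁ ∈ᵥ s × InDCycle d h x₁)
      (λ { (s , h) (.s , h') (refl , h≗h') (x₁∉s , x₁∈C) → x₁∉s , InDCycle-resp d {h} {h'} h≗h' x₁ x₁∈C })
      (λ g (_ , _ , x₀∈C) (x₁∈C , separated) →
         let x₁∉o : ¬ x₁ ∈ᵥ orbit g x₀
             x₁∉o = λ (k , eq) → separated (toℕ k) (trans (sym (lookup-orbit g x₀ k)) eq)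
         in x₁∉o , Orbit.InDCycle-rest g x₀ x₀∈C x₁ x₁∉o x₁∈C)
      (λ g (_ , _ , x₀∈C) (x₁∉o , x₁∈C) →
         Orbit.InDCycle-rest⁻ g x₀ x₀∈C x₁ x₁∉o x₁∈C ,
         λ m eq → x₁∉o (subst (_∈ᵥ orbit g x₀) eq (Orbit.iterate∈orbit g x₀ x₀∈C m)))
      (λ s → Arrangement (all ─ x₁) s × lookup s zero ≡ x₀)
      (λ s h → (Sym (all ∖ s) h × dPoints (all ∖ s) h + d ≡ 2 * d) × InDCycle d h x₁) arrangements F
      (λ t → HasCard-resp permSetoid (proj₁ (proj₂ (inner t)))
         (λ h (h∈Sym , eq , x₁∈C) → (h∈Sym , trans (cong (_+ d) eq) (ℕP.+-comm (1 * d) d)) , x₁∈C)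
         (λ h ((h∈Sym , eq) , x₁∈C) → h∈Sym , ℕP.+-cancelʳ-≡ d _ (1 * d) (trans eq (ℕP.+-comm d (1 * d))) , x₁∈C))
      (λ { (s , h) ((s-arr , s₀≡x₀ , h∈Sym , eq) , x₁∉s , x₁∈C) →
             (Arrangement-─⁺ all x₁ s s-arr x₁∉s , s₀≡x₀) , (h∈Sym , eq) , x₁∈C })
      (λ { (s , h) ((s-arr , s₀≡x₀) , (h∈Sym , eq) , x₁∈C) → let (s-arr' , x₁∉s) = Arrangement-─⁻ all x₁ s s-arr in
             (s-arr' , s₀≡x₀ , h∈Sym , eq) , x₁∉s , x₁∈C })
    to-D : ∀ g → Rooted g × Separated g → SetD d g
    to-D g ((_ , dPoints≡2d , x₀∈C) , x₁∈C , separated) =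
      ⇒ExactlyDCycles 2 g dPoints≡2d , x₀ , x₁ , refl , refl , x₀∈C , x₁∈C , separated
    from-D : ∀ g → SetD d g → Rooted g × Separated g
    from-D g (g∈B , x , y , x≡0 , y≡1 , x∈C , y∈C , separated)
      with FinP.toℕ-injective {i = x} {j = x₀} x≡0 | FinP.toℕ-injective {i = y} {j = x₁} y≡1
    ... | refl | refl = (Sym-all g , ExactlyDCycles⇒ 2 g g∈B , x∈C) , y∈C , separated

2d≤n⇒n≡2+d'+r : ∀ d' n → 2 * suc d' ≤ n → ∃ λ r → d' ≤ r × n ≡ suc (suc (d' + r))
2d≤n⇒n≡2+d'+r d' n 2d≤n = d' + k , ℕP.m≤m+n d' k ,
  trans (sym (ℕP.m+[n∸m]≡n 2d≤n))
    (solve 2 (λ a b → con 2 :* (con 1 :+ a) :+ b := con 2 :+ (a :+ (a :+ b))) refl d' k)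
  where
  open ℕ-Solver
  k : ℕ
  k = n ∸ 2 * suc d'

lemma2p3 : (d : ℕ) → .{{_ : NonZero d}} → (n : ℕ) → (hn : 2 ℕ.* d ≤ n) →
    let i = n / d in
    (∃ λ k → HasCardPerm {n} (HasDCycle d) k ×
       ℕtoℚ (n !) ℚ.* aSeq d i ≡ ℕtoℚ k)
    × (∀ j → 1 ≤ j → j ≤ i →
       ∃ λ k → HasCardPerm {n} (ExactlyDCycles d j) k ×
         ℕtoℚ (n !) ℚ.* bSeq d i j ≡ ℕtoℚ k)
    × (∃ λ k → HasCardPerm {n} (SetC d) k ×
       ℕtoℚ (n !) ℚ.* (ℚ._/_ (+ (2 ℕ.* n ∸ d ∸ 1)) (n ℕ.* (n ∸ 1)) {{nn-1≢0 d n hn}})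
         ℚ.* (1ℚ - aSeq d (i ∸ 1)) ≡ ℕtoℚ k)
    × (∃ λ k → HasCardPerm {n} (SetD d) k ×
       ℕtoℚ (n !) ℚ.* (ℚ._/_ (+ 1) (n ℕ.* (n ∸ 1)) {{nn-1≢0 d n hn}})
         ℚ.* (1ℚ - aSeq d (i ∸ 2)) ≡ ℕtoℚ k)
lemma2p3 (suc d') n hn with 2d≤n⇒n≡2+d'+r d' n hn
... | r , d'≤r , refl = part-a , part-b , part-c , part-d
  where open Parts d' r d'≤r
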